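{- Suppose that $|g_{i,\{j\}}\cap[n]| \equiv 0 \bmod 2$ for all $i \in [m]$ and all $j \in [n]$. Let $f_1,\dots,f_n \subseteq [n]\cup\{ -\}$ satisfy $f_j \in V_{\{j\}}$, $j \notin f_j$, and $|\{i\}\cap f_j| = |\{j\}\cap f_i|$ for all $i,j\in[n]$. Let $\lambda \in \mathbb{Q}^\times$, $\mathbf{a}\in(\mathbb{Q}^\times)^n$ and let $v$ be a place of $\mathbb{Q}$. Then \[ \operatorname{Tw}_v(f,\mathbf{a})\operatorname{Tw}_v(f,\lambda\mathbf{a}) = (-1,\lambda)_v^{\sum_{i\in[n]}|\{ -\}\cap f_i| + \sum_{\{i,j\}\subseteq[n]}|\{j\}\cap f_i|}. \]
   Context: Setting: integers $n \geq 2$, $m \geq 1$ and squarefree monomials $M_{i,j}(t_1,\dots,t_n)$ ($i \in [m]$, $j \in \{1,2,3\}$, $[n]=\{1,\dots,n\}$) with leading coefficient $\pm1$, with $M_{i,1},M_{i,2},M_{i,3}$ pairwise coprime for each $i$. View $\mathcal{P}([n]\cup\{ -\})$ ($-$ a formal symbol) as an $\mathbb{F}_2$-vector space under symmetric difference $+$. Encode a monomial $\pm\prod_{l\in S'}t_l$ as $S'$ (sign $+$) or $S'\cup\{ -\}$ (sign $-$); let $S_{i,k}$ encode $M_{i,k}$. For $j\in[n]$ put $g_{i,\{j\}} = \varnothing$ if $j\notin S_{i,1}\cup S_{i,2}\cup S_{i,3}$, and $g_{i,\{j\}} = \{ -\}+S_{i,k'}+S_{i,k''}$ if $j \in S_{i,k}$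 where $\{k,k',k''\}=\{1,2,3\}$. Let $V_{\{j\}}$ be the span of $\{g_{i,\{j\}}: i\in[m]\}$. Sums over $\{i,j\}\subseteq[n]$ run over unordered pairs of distinct elements. For $\mathbf{a}=(a_1,\dots,a_n)\in(\mathbb{Q}^\times)^n$, \[ \operatorname{Tw}_v(f,\mathbf{a}) = \prod_{i\in[n]}(-1,a_i)_v^{|\{ -\}\cap f_i|}\prod_{\{i,j\}\subseteq[n]}(a_i,a_j)_v^{|\{j\}\cap f_i|}, \] with $(\cdot,\cdot)_v$ the Hilbert symbol at $v$, and $\lambda\mathbf{a} = (\lambda a_1,\dots,\lambda a_n)$. -}

module Defs where

open import Data.Bool using (Bool; true; false; not; _∧_; _∨_; _xor_; if_then_else_)
open import Data.Nat as ℕ using (ℕ; zero; suc; _≡ᵇ_; _<ᵇ_)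
open import Data.Nat.DivMod using (_%_; _/_)
open import Data.Nat.Primality using (Prime)
open import Data.Integer as ℤ using (ℤ; +_; -[1+_]; _◃_; sign; ∣_∣)
open import Data.Integer.DivMod using (_%ℕ_)
open import Data.Rational using (ℚ; ↥_; ↧ₙ_)
open import Data.Fin using (Fin; toℕ) renaming (zero to fz; suc to fs)
open import Data.Vec using (Vec; lookup; zipWith; tail; replicate; _∷_; [])
open import Data.Fin.Subset using (Subset)
open import Data.List using (upTo)
open import Data.Bool.ListAction using (any)

-- Subsets of [n] ∪ {-} as F₂-vectors.
-- Index fz encodes the formal symbol '-', index (fs j) encodes the
-- element j of [n] (with [n] realised as Fin n).

SetN- : ℕ → Set
SetN- n = Subset (suc n)

minusIdx : ∀ {n} → Fin (suc n)
minusIdx = fz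

elemIdx : ∀ {n} → Fin n → Fin (suc n)
elemIdx = fs

_⊕_ : ∀ {n} → Subset n → Subset n → Subset n
_⊕_ = zipWith _xor_

∅ : ∀ {n} → Subset n
∅ = replicate _ false

minusSet : ∀ {n} → SetN- n
minusSet = true ∷ ∅

-- indicator: |{x} ∩ A| as a natural number (0 or 1)
ind : Bool → ℕ
ind true = 1
ind false = 0

cardN : ∀ {n} → SetN- n → ℕ
cardN A = Data.Fin.Subset.∣ tail A ∣

memN : ∀ {n} → Fin n → SetN- n → Bool
memN j A = lookup A (elemIdx j)

-- The data: S i k encodes the monomial M_{i,k} (k ∈ Fin 3 ≅ {1,2,3}).

Monos : ℕ → ℕ → Set
Monos n m = Fin m → Fin 3 → SetN- n

PairwiseCoprime : ∀ {n m} → Monos n m → Set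
PairwiseCoprime {n} S = ∀ i (k k' : Fin 3) (j : Fin n) → ¬≡ k k' →
    memN j (S i k) ≡ true → memN j (S i k') ≡ false
  where
    open import Relation.Binary.PropositionalEquality using (_≡_)
    open import Relation.Nullary using (¬_)
    ¬≡ : Fin 3 → Fin 3 → Set
    ¬≡ a b = ¬ (a ≡ b)

g : ∀ {n m} → Monos n m → Fin m → Fin n → SetN- n
g S i j =
  if memN j (S i fz) then minusSet ⊕ (S i (fs fz) ⊕ S i (fs (fs fz)))
  else if memN j (S i (fs fz)) then minusSet ⊕ (S i fz ⊕ S i (fs (fs fz)))
  else if memN j (S i (fs (fs fz))) then minusSet ⊕ (S i fz ⊕ S i (fs fz))
  else ∅

linComb : ∀ {n m} → (Fin m → Bool) → (Fin m → Subset n) → Subset n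
linComb {m = zero}  c v = ∅
linComb {m = suc m} c v =
  (if c fz then v fz else ∅) ⊕ linComb (λ i → c (fs i)) (λ i → v (fs i))

open import Data.Product using (Σ)
open import Relation.Binary.PropositionalEquality using (_≡_)

InSpan : ∀ {n m} → (Fin m → Subset n) → Subset n → Set
InSpan v A = Σ (_ → Bool) (λ c → A ≡ linComb c v)

InV : ∀ {n m} → Monos n m → Fin n → SetN- n → Set
InV S j A = InSpan (λ i → g S i j) A

-- Finite products / sums over [n] and over unordered pairs {i,j} ⊆ [n]
-- (an unordered pair is enumerated once, as (i,j) with i < j).

prodFin : ∀ {n} → (Fin n → ℤ) → ℤ
prodFin {zero} f = + 1
prodFin {suc n} f = f fz ℤ.* prodFin (λ i → f (fs i))

sumFin : ∀ {n} → (Fin n → ℕ) → ℕ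
sumFin {zero} f = 0
sumFin {suc n} f = f fz ℕ.+ sumFin (λ i → f (fs i))

prodPairs : ∀ {n} → (Fin n → Fin n → ℤ) → ℤ
prodPairs f = prodFin (λ i → prodFin (λ j → if toℕ i <ᵇ toℕ j then f i j else + 1))

sumPairs : ∀ {n} → (Fin n → Fin n → ℕ) → ℕ
sumPairs f = sumFin (λ i → sumFin (λ j → if toℕ i <ᵇ toℕ j then f i j else 0))

-- Places of ℚ and the Hilbert symbol (explicit formulas, Serre,
-- "A Course in Arithmetic", Ch. III, Thm. 1).

data Place : Set where
  ∞   : Place
  fin : (p : ℕ) → Prime p → Place

isNeg : ℤ → Bool
isNeg -[1+ _ ] = true
isNeg (+ _)    = false

-- p-adic valuation of a natural number (0 for 0), with fuel; p = 2+q
valℕ : (q : ℕ) → ℕ → ℕ → ℕ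
valℕ q zero    x = 0
valℕ q (suc k) x =
  if x ≡ᵇ 0 then 0
  else if x % suc (suc q) ≡ᵇ 0 then suc (valℕ q k (x / suc (suc q)))
  else 0

stripℕ : (q : ℕ) → ℕ → ℕ → ℕ
stripℕ q zero    x = x
stripℕ q (suc k) x =
  if x ≡ᵇ 0 then 0
  else if x % suc (suc q) ≡ᵇ 0 then stripℕ q k (x / suc (suc q))
  else x

-- parity of v_p(a) for a ∈ ℚ (v_p(a) = v_p(num) - v_p(den))
oddVal : (q : ℕ) → ℚ → Bool
oddVal q a =
  let nn = ∣ ↥ a ∣ ; d = ↧ₙ a in
  ((valℕ q nn nn ℕ.+ valℕ q d d) % 2) ≡ᵇ 1

-- a = p^α · (r / s) with r ∈ ℤ, s ∈ ℕ prime to p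
unitNum : (q : ℕ) → ℚ → ℤ
unitNum q a = sign (↥ a) ◃ stripℕ q ∣ ↥ a ∣ ∣ ↥ a ∣

unitDen : (q : ℕ) → ℚ → ℤ
unitDen q a = + stripℕ q (↧ₙ a) (↧ₙ a)

-- Legendre symbol (x/p) for p = 3+q odd, as an F₂-bit (true ↔ -1):
-- (x/p) = 1 iff x is a square mod p
legBit : (q : ℕ) → ℤ → Bool
legBit q x = not (any (λ y → ((y ℕ.* y) % suc (suc (suc q))) ≡ᵇ (x %ℕ suc (suc (suc q))))
                      (upTo (suc (suc (suc q)))))

-- ε(u) = (u-1)/2 mod 2 and ω(u) = (u²-1)/8 mod 2 for an odd integer u
epsBit : ℤ → Bool
epsBit x = let r = x %ℕ 8 in (r ≡ᵇ 3) ∨ (r ≡ᵇ 7)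

omegaBit : ℤ → Bool
omegaBit x = let r = x %ℕ 8 in (r ≡ᵇ 3) ∨ (r ≡ᵇ 5)

-- Hilbert symbol as an F₂-bit (true ↔ (a,b)_v = -1)
hilbertBit : Place → ℚ → ℚ → Bool
hilbertBit ∞ a b = isNeg (↥ a) ∧ isNeg (↥ b)
hilbertBit (fin zero _) a b = false
hilbertBit (fin (suc zero) _) a b = false
hilbertBit (fin (suc (suc zero)) _) a b =
  let α = oddVal 0 a ; β = oddVal 0 b
      εu = epsBit (unitNum 0 a) xor epsBit (unitDen 0 a)
      εv = epsBit (unitNum 0 b) xor epsBit (unitDen 0 b)
      ωu = omegaBit (unitNum 0 a) xor omegaBit (unitDen 0 a)
      ωv = omegaBit (unitNum 0 b) xor omegaBit (unitDen 0 b)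
  in (εu ∧ εv) xor ((α ∧ ωv) xor (β ∧ ωu))
hilbertBit (fin (suc (suc (suc q))) _) a b =
  let α = oddVal (suc q) a ; β = oddVal (suc q) b
      εp = ((suc (suc q) / 2) % 2) ≡ᵇ 1
      lu = legBit q (unitNum (suc q) a) xor legBit q (unitDen (suc q) a)
      lv = legBit q (unitNum (suc q) b) xor legBit q (unitDen (suc q) b)
  in (α ∧ β ∧ εp) xor ((β ∧ lu) xor (α ∧ lv))

hilbert : Place → ℚ → ℚ → ℤ
hilbert v a b = if hilbertBit v a b then ℤ.- (+ 1) else + 1

Tw : ∀ {n} → Place → (Fin n → SetN- n) → (Fin n → ℚ) → ℤ
Tw v f a =
  prodFin (λ i → hilbert v (Data.Rational.- Data.Rational.1ℚ) (a i) ℤ.^ ind (lookup (f i) minusIdx))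
  ℤ.* prodPairs (λ i j → hilbert v (a i) (a j) ℤ.^ ind (memN j (f i)))

scale : ∀ {n} → ℚ → (Fin n → ℚ) → (Fin n → ℚ)
scale λ' a i = λ' Data.Rational.* a i

{-# OPTIONS --safe #-}

-- Write (a , b)_v = (-1)^(H_v a b) with H_v a b ∈ 𝔽₂. At every place v the explicit formula for
-- H_v is built from homomorphisms ℚ^× → 𝔽₂ (the sign, the parity of the p-adic valuation, and ε, ω
-- resp. the Legendre symbol of the p-adic unit part, the latter multiplicative by Euler's criterion),
-- so H_v is symmetric and bilinear, with H_v a a = H_v (-1) a. Hence
--   H_v (λ a_i) (λ a_j) = H_v a_i a_j + H_v λ a_i + H_v λ a_j + H_v (-1) λ  and
--   H_v (-1) (λ a_i) = H_v (-1) λ + H_v (-1) a_i.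
-- In the exponent of Tw_v(f, a) Tw_v(f, λa) the terms H_v λ a_i then occur with multiplicity
-- Σ_j |{j} ∩ f_i| = |f_i ∩ [n]| (by the symmetry of f and j ∉ f_j), which is even because f_i lies
-- in V_{i}, spanned by sets meeting [n] evenly. What is left is H_v (-1) λ times the stated exponent.

module Submission where

open import Defs
open import Data.Bool using (Bool; true; false; not; _∧_; _xor_; if_then_else_; T)
open import Data.Empty using (⊥-elim)
open import Data.Fin as Fin using (Fin; toℕ) renaming (zero to fz; suc to fs)
import Data.Fin.Properties as Fin
open import Data.Nat as ℕ using (ℕ; zero; suc; _≡ᵇ_; _<ᵇ_; _<_; _≤_; _≥_; z≤n; s≤s)
import Data.Nat.Properties as ℕ
import Data.Nat.DivMod as ℕ
import Data.Nat.Divisibility as ℕ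
open import Data.Nat.Primality using (Prime; euclidsLemma; prime⇒irreducible)
open import Data.Integer as ℤ using (ℤ; +_; _+_; _-_; _*_; _^_)
import Data.Integer.Properties as ℤ
open import Data.Integer.DivMod using (n%ℕd<d; a≡a%ℕn+[a/ℕn]*n)
open import Data.Integer.Tactic.RingSolver using (solve-∀)
import Tactic.RingSolver as RingSolver
open import Data.Rational as ℚ using (ℚ; ↥_; ↧_; ↧ₙ_; 0ℚ; 1ℚ)
import Data.Rational.Properties as ℚ
open import Data.Product using (Σ-syntax; _×_; _,_; proj₁; proj₂)
open import Data.Sum as Sum using (_⊎_; inj₁; inj₂; [_,_]′)
open import Function using (_∘_; case_of_)
open import Relation.Nullary using (¬_; does; yes; no)
open import Relation.Binary.PropositionalEquality
open import Relation.Binary.Definitions using (tri<; tri≈; tri>)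

module Bits where

  open import Data.Maybe using (just; nothing)
  open import Level using (0ℓ)
  open import Data.Bool.Properties
    using (xor-∧-commutativeRing; xor-same; xor-identityʳ; xor-assoc; not-distribˡ-xor; not-involutive)
  open import Data.Integer using (-_)
  open import Tactic.RingSolver.Core.AlmostCommutativeRing using (AlmostCommutativeRing; fromCommutativeRing)

  𝔽₂ : AlmostCommutativeRing 0ℓ 0ℓ
  𝔽₂ = fromCommutativeRing xor-∧-commutativeRing λ { false → just refl ; true → nothing }

  xor-interchange : ∀ a b c d → (a xor b) xor (c xor d) ≡ (a xor c) xor (b xor d)
  xor-interchange = RingSolver.solve-∀ 𝔽₂

  xor-cancelˡ : ∀ a b → a xor (a xor b) ≡ b
  xor-cancelˡ a b = begin
    a xor (a xor b)   ≡⟨ xor-assoc a a b ⟨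
    (a xor a) xor b   ≡⟨ cong (_xor b) (xor-same a) ⟩
    b                 ∎
    where open ≡-Reasoning

  xor-cancel-common : ∀ a b g → (a xor g) xor (b xor g) ≡ a xor b
  xor-cancel-common a b g = begin
    (a xor g) xor (b xor g)    ≡⟨ rearrange a b g ⟩
    (a xor b) xor (g xor g)    ≡⟨ cong ((a xor b) xor_) (xor-same g) ⟩
    (a xor b) xor false        ≡⟨ xor-identityʳ (a xor b) ⟩
    a xor b                    ∎
    where
      open ≡-Reasoning
      rearrange : ∀ a b g → (a xor g) xor (b xor g) ≡ (a xor b) xor (g xor g)
      rearrange = RingSolver.solve-∀ 𝔽₂

  sgn : Bool → ℤ
  sgn b = if b then - + 1 else + 1

  sgn-xor : ∀ a b → sgn (a xor b) ≡ sgn a * sgn b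
  sgn-xor true  true  = refl
  sgn-xor true  false = refl
  sgn-xor false true  = refl
  sgn-xor false false = refl

  odd : ℕ → Bool
  odd zero    = false
  odd (suc n) = not (odd n)

  odd-+ : ∀ m n → odd (m ℕ.+ n) ≡ odd m xor odd n
  odd-+ zero    n = refl
  odd-+ (suc m) n = trans (cong not (odd-+ m n)) (not-distribˡ-xor (odd m) (odd n))

  odd≡%2≡ᵇ1 : ∀ n → odd n ≡ (n ℕ.% 2 ≡ᵇ 1)
  odd≡%2≡ᵇ1 zero          = refl
  odd≡%2≡ᵇ1 (suc zero)    = refl
  odd≡%2≡ᵇ1 (suc (suc n)) = trans (not-involutive (odd n)) (trans (odd≡%2≡ᵇ1 n)
    (cong (_≡ᵇ 1) (sym (trans (cong (ℕ._% 2) (ℕ.+-comm 2 n)) (ℕ.[m+n]%n≡m%n n 2)))))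

  -1^≡sgn∘odd : ∀ k → (- + 1) ^ k ≡ sgn (odd k)
  -1^≡sgn∘odd zero    = refl
  -1^≡sgn∘odd (suc k) = trans (cong ((- + 1) *_) (-1^≡sgn∘odd k)) (lemma (odd k))
    where lemma : ∀ b → - + 1 * sgn b ≡ sgn (not b)
          lemma true  = refl
          lemma false = refl

  sgn^ : ∀ b k → sgn b ^ k ≡ sgn (b ∧ odd k)
  sgn^ true  k = -1^≡sgn∘odd k
  sgn^ false k = ℤ.^-zeroˡ k

  even⇒odd≡false : ∀ {k} → 2 ℕ.∣ k → odd k ≡ false
  even⇒odd≡false {k} 2∣k = trans (odd≡%2≡ᵇ1 k) (cong (_≡ᵇ 1) (ℕ.n∣m⇒m%n≡0 k 2 2∣k))

  double-injective : ∀ {k j} → k ℕ.+ k ≡ j ℕ.+ j → k ≡ j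
  double-injective {k} {j} eq = ℕ.*-cancelˡ-≡ k j 2 (trans (double k) (trans eq (sym (double j))))
    where double : ∀ n → 2 ℕ.* n ≡ n ℕ.+ n
          double n = cong (n ℕ.+_) (ℕ.+-identityʳ n)

module Congruence (m : ℤ) where

  open import Data.Integer using (-_)
  open import Data.Integer.Divisibility.Signed using (_∣_; divides; ∣m∣n⇒∣m+n; ∣m⇒∣-m; ∣m⇒∣m*n; ∣n⇒∣m*n)
  open import Relation.Binary.Bundles using (Setoid)
  open import Relation.Binary.Structures using (IsEquivalence)
  import Relation.Binary.Reasoning.Setoid

  infix 4 _≈_
  record _≈_ (x y : ℤ) : Set where
    constructor mk≈
    field divides-difference : m ∣ x - y

  open _≈_ public

  ∣⇒≈0 : ∀ {x} → m ∣ x → x ≈ + 0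
  ∣⇒≈0 {x} m∣x = mk≈ (subst (m ∣_) (sym (ℤ.+-identityʳ x)) m∣x)

  ≈0⇒∣ : ∀ {x} → x ≈ + 0 → m ∣ x
  ≈0⇒∣ {x} (mk≈ m∣x) = subst (m ∣_) (ℤ.+-identityʳ x) m∣x

  ≈-refl : ∀ {x} → x ≈ x
  ≈-refl {x} = mk≈ (subst (m ∣_) (sym (ℤ.+-inverseʳ x)) (divides (+ 0) (sym (ℤ.*-zeroˡ m))))

  ≈-reflexive : ∀ {x y} → x ≡ y → x ≈ y
  ≈-reflexive refl = ≈-refl

  ≈-sym : ∀ {x y} → x ≈ y → y ≈ x
  ≈-sym {x} {y} (mk≈ d) = mk≈ (subst (m ∣_) (identity x y) (∣m⇒∣-m d))
    where identity : ∀ x y → - (x - y) ≡ y - x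
          identity = solve-∀

  ≈-trans : ∀ {x y z} → x ≈ y → y ≈ z → x ≈ z
  ≈-trans {x} {y} {z} (mk≈ d) (mk≈ e) = mk≈ (subst (m ∣_) (identity x y z) (∣m∣n⇒∣m+n d e))
    where identity : ∀ x y z → (x - y) + (y - z) ≡ x - z
          identity = solve-∀

  ≈-isEquivalence : IsEquivalence _≈_
  ≈-isEquivalence = record { refl = ≈-refl ; sym = ≈-sym ; trans = ≈-trans }

  ≈-setoid : Setoid _ _
  ≈-setoid = record { isEquivalence = ≈-isEquivalence }

  module ≈-Reasoning = Relation.Binary.Reasoning.Setoid ≈-setoid

  +-cong : ∀ {a b c d} → a ≈ b → c ≈ d → a + c ≈ b + d
  +-cong {a} {b} {c} {d} (mk≈ e) (mk≈ f) = mk≈ (subst (m ∣_) (identity a b c d) (∣m∣n⇒∣m+n e f))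
    where identity : ∀ a b c d → (a - b) + (c - d) ≡ (a + c) - (b + d)
          identity = solve-∀

  *-cong : ∀ {a b c d} → a ≈ b → c ≈ d → a * c ≈ b * d
  *-cong {a} {b} {c} {d} (mk≈ e) (mk≈ f) =
    mk≈ (subst (m ∣_) (identity a b c d) (∣m∣n⇒∣m+n (∣m⇒∣m*n c e) (∣n⇒∣m*n b f)))
    where identity : ∀ a b c d → (a - b) * c + b * (c - d) ≡ a * c - b * d
          identity = solve-∀

  neg-cong : ∀ {a b} → a ≈ b → - a ≈ - b
  neg-cong {a} {b} (mk≈ e) = mk≈ (subst (m ∣_) (identity a b) (∣m⇒∣-m e))
    where identity : ∀ a b → - (a - b) ≡ - a - - b
          identity = solve-∀

  +-multiple : ∀ x k → x + k * m ≈ x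
  +-multiple x k = mk≈ (divides k (identity x k m))
    where identity : ∀ x k m → x + k * m - x ≡ k * m
          identity = solve-∀

module CongruenceModℕ (d : ℕ) .{{_ : ℕ.NonZero d}} where

  open import Data.Integer.Divisibility.Signed using (∣⇒∣ᵤ)

  open Congruence (+ d) public

  ≈-%ℕ : ∀ x → x ≈ + (x ℤ.%ℕ d)
  ≈-%ℕ x = ≈-trans (≈-reflexive (a≡a%ℕn+[a/ℕn]*n x d)) (+-multiple (+ (x ℤ.%ℕ d)) (x ℤ./ℕ d))

  private
    ordered-≈⇒≡ : ∀ {r s} → r ≤ s → s < d → + r ≈ + s → r ≡ s
    ordered-≈⇒≡ {r} {s} r≤s s<d (mk≈ d∣r-s) with s ℕ.∸ r in s∸r≡
    ... | zero  = ℕ.≤-antisym r≤s (ℕ.m∸n≡0⇒m≤n s∸r≡)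
    ... | suc k = ⊥-elim (ℕ.>⇒∤ suc-k<d d∣suc-k)
      where
        suc-k<d : suc k < d
        suc-k<d = ℕ.≤-<-trans (subst (_≤ s) s∸r≡ (ℕ.m∸n≤m s r)) s<d
        d∣suc-k : d ℕ.∣ suc k
        d∣suc-k = subst (d ℕ.∣_) (trans (cong ℤ.∣_∣ (ℤ.m-n≡m⊖n r s)) (trans (ℤ.∣⊖∣-≤ r≤s) s∸r≡))
                    (∣⇒∣ᵤ d∣r-s)

  ≈⇒≡ : ∀ {r s} → r < d → s < d → + r ≈ + s → r ≡ s
  ≈⇒≡ {r} {s} r<d s<d r≈s with ℕ.≤-total r s
  ... | inj₁ r≤s = ordered-≈⇒≡ r≤s s<d r≈s
  ... | inj₂ s≤r = sym (ordered-≈⇒≡ s≤r r<d (≈-sym r≈s))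

  ≈⇒%ℕ≡ : ∀ {x y} → x ≈ y → x ℤ.%ℕ d ≡ y ℤ.%ℕ d
  ≈⇒%ℕ≡ {x} {y} x≈y = ≈⇒≡ (n%ℕd<d x d) (n%ℕd<d y d)
    (≈-trans (≈-sym (≈-%ℕ x)) (≈-trans x≈y (≈-%ℕ y)))

module Counting where

  open import Data.Bool.Properties using (∧-identityʳ; ∧-zeroʳ)
  open import Relation.Nullary.Decidable using (dec-true; dec-false)
  open import Algebra.Properties.CommutativeSemigroup ℤ.*-commutativeSemigroup using (xy∙z≈xz∙y)

  prodWhere : (ℕ → Bool) → ℕ → ℤ
  prodWhere P zero    = + 1
  prodWhere P (suc N) = prodWhere P N * (if P N then + N else + 1)

  countWhere : (ℕ → Bool) → ℕ → ℕ
  countWhere P zero    = 0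
  countWhere P (suc N) = countWhere P N ℕ.+ (if P N then 1 else 0)

  without : ℕ → (ℕ → Bool) → ℕ → Bool
  without a P x = P x ∧ not (does (x ℕ.≟ a))

  without-≢ : ∀ {a} P {x} → x ≢ a → without a P x ≡ P x
  without-≢ {a} P {x} x≢a rewrite dec-false (x ℕ.≟ a) x≢a = ∧-identityʳ (P x)

  without-self : ∀ a P → without a P a ≡ false
  without-self a P rewrite dec-true (a ℕ.≟ a) refl = ∧-zeroʳ (P a)

  without-true : ∀ {a} P {x} → without a P x ≡ true → P x ≡ true × x ≢ a
  without-true {a} P {x} eq = ∧-true⇒true (P x) eq , x≢a
    where
      ∧-true⇒true : ∀ b {c} → b ∧ c ≡ true → b ≡ true
      ∧-true⇒true true _ = refl
      x≢a : x ≢ a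
      x≢a refl with () ← trans (sym eq) (without-self x P)

  without-intro : ∀ {a} P {x} → P x ≡ true → x ≢ a → without a P x ≡ true
  without-intro P Px x≢a = trans (without-≢ P x≢a) Px

  prodWhere-cong : ∀ {P Q} N → (∀ {x} → x < N → P x ≡ Q x) → prodWhere P N ≡ prodWhere Q N
  prodWhere-cong zero    P≗Q = refl
  prodWhere-cong (suc N) P≗Q =
    cong₂ (λ r b → r * (if b then + N else + 1)) (prodWhere-cong N (P≗Q ∘ ℕ.m<n⇒m<1+n)) (P≗Q ℕ.≤-refl)

  countWhere-cong : ∀ {P Q} N → (∀ {x} → x < N → P x ≡ Q x) → countWhere P N ≡ countWhere Q N
  countWhere-cong zero    P≗Q = refl
  countWhere-cong (suc N) P≗Q =
    cong₂ (λ r b → r ℕ.+ (if b then 1 else 0)) (countWhere-cong N (P≗Q ∘ ℕ.m<n⇒m<1+n)) (P≗Q ℕ.≤-refl)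

  private
    without-below : ∀ {a} P {x} → x < a → P x ≡ without a P x
    without-below P x<a = sym (without-≢ P (ℕ.<⇒≢ x<a))

  prodWhere-without : ∀ {a} P N → a < N → P a ≡ true → prodWhere P N ≡ prodWhere (without a P) N * + a
  prodWhere-without {a} P (suc N) a<1+N Pa with ℕ.<-cmp a N
  ... | tri< a<N _ _ rewrite without-≢ P (ℕ.>⇒≢ a<N) =
    trans (cong (_* (if P N then + N else + 1)) (prodWhere-without P N a<N Pa))
          (xy∙z≈xz∙y (prodWhere (without a P) N) (+ a) (if P N then + N else + 1))
  ... | tri≈ _ refl _ rewrite without-self a P | Pa =
    cong (_* + a) (trans (prodWhere-cong a (without-below P)) (sym (ℤ.*-identityʳ _)))
  ... | tri> _ _ a>N = ⊥-elim (ℕ.<⇒≱ a>N (ℕ.≤-pred a<1+N))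

  countWhere-without : ∀ {a} P N → a < N → P a ≡ true → countWhere P N ≡ suc (countWhere (without a P) N)
  countWhere-without {a} P (suc N) a<1+N Pa with ℕ.<-cmp a N
  ... | tri< a<N _ _ rewrite without-≢ P (ℕ.>⇒≢ a<N) =
    cong (ℕ._+ (if P N then 1 else 0)) (countWhere-without P N a<N Pa)
  ... | tri≈ _ refl _ rewrite without-self a P | Pa =
    trans (ℕ.+-comm (countWhere P a) 1)
          (cong suc (trans (countWhere-cong a (without-below P)) (sym (ℕ.+-identityʳ _))))
  ... | tri> _ _ a>N = ⊥-elim (ℕ.<⇒≱ a>N (ℕ.≤-pred a<1+N))

  member : ∀ P N {k} → countWhere P N ≡ suc k → Σ[ a ∈ ℕ ] a < N × P a ≡ true
  member P (suc N) count≡ with P N in PN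
  ... | true  = N , ℕ.≤-refl , PN
  ... | false =
    let a , a<N , Pa = member P N (trans (sym (ℕ.+-identityʳ (countWhere P N))) count≡)
    in a , ℕ.m<n⇒m<1+n a<N , Pa

  prodWhere-empty : ∀ P N → countWhere P N ≡ 0 → prodWhere P N ≡ + 1
  prodWhere-empty P zero    _ = refl
  prodWhere-empty P (suc N) count≡0 with P N
  ... | false = trans (ℤ.*-identityʳ _) (prodWhere-empty P N (trans (sym (ℕ.+-identityʳ _)) count≡0))
  ... | true  = ⊥-elim (ℕ.1+n≢0 (trans (ℕ.+-comm 1 (countWhere P N)) count≡0))

module Pairing (m : ℤ) (N : ℕ) (σ : ℕ → ℕ) (c : ℤ) where

  open Counting
  open Congruence m

  PairsOff : (ℕ → Bool) → Set
  PairsOff P = ∀ {x} → x < N → P x ≡ true →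
    σ x < N × P (σ x) ≡ true × σ (σ x) ≡ x × σ x ≢ x × + x * + σ x ≈ c

  withoutPair : ℕ → (ℕ → Bool) → ℕ → Bool
  withoutPair a P = without (σ a) (without a P)

  withoutPair-pairsOff : ∀ {P a} → PairsOff P → σ (σ a) ≡ a → PairsOff (withoutPair a P)
  withoutPair-pairsOff {P} {a} pairs σσa≡a {x} x<N P₂x
    with without-true (without a P) P₂x
  ... | P₁x , x≢σa with without-true P P₁x
  ... | Px , x≢a with pairs x<N Px
  ... | σx<N , Pσx , σσx≡x , σx≢x , xσx≈c =
    σx<N , without-intro (without a P) (without-intro P Pσx σx≢a) σx≢σa , σσx≡x , σx≢x , xσx≈c
    where
      σx≢a : σ x ≢ a
      σx≢a σx≡a = x≢σa (trans (sym σσx≡x) (cong σ σx≡a))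
      σx≢σa : σ x ≢ σ a
      σx≢σa σx≡σa = x≢a (trans (sym σσx≡x) (trans (cong σ σx≡σa) σσa≡a))

  removePair : ∀ {P a} → PairsOff P → a < N → P a ≡ true →
    countWhere P N ≡ suc (suc (countWhere (withoutPair a P) N)) ×
    prodWhere P N ≈ prodWhere (withoutPair a P) N * c ×
    PairsOff (withoutPair a P)
  removePair {P} {a} pairs a<N Pa with pairs a<N Pa
  ... | σa<N , Pσa , σσa≡a , σa≢a , aσa≈c =
    trans (countWhere-without P N a<N Pa) (cong suc (countWhere-without (without a P) N σa<N P₁σa)) ,
    (begin
      prodWhere P N                          ≡⟨ prodWhere-without P N a<N Pa ⟩
      prodWhere P₁ N * + a                   ≡⟨ cong (_* + a) (prodWhere-without P₁ N σa<N P₁σa) ⟩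
      prodWhere P₂ N * + σ a * + a           ≡⟨ ℤ.*-assoc (prodWhere P₂ N) (+ σ a) (+ a) ⟩
      prodWhere P₂ N * (+ σ a * + a)         ≡⟨ cong (prodWhere P₂ N *_) (ℤ.*-comm (+ σ a) (+ a)) ⟩
      prodWhere P₂ N * (+ a * + σ a)         ≈⟨ *-cong (≈-refl {prodWhere P₂ N}) aσa≈c ⟩
      prodWhere P₂ N * c                     ∎) ,
    withoutPair-pairsOff pairs σσa≡a
    where
      open ≈-Reasoning
      P₁ = without a P
      P₂ = withoutPair a P
      P₁σa : P₁ (σ a) ≡ true
      P₁σa = without-intro P Pσa σa≢a

  prodWhere-paired : ∀ n {P} → countWhere P N ≡ n → PairsOff P →
    Σ[ k ∈ ℕ ] n ≡ k ℕ.+ k × prodWhere P N ≈ c ^ k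
  prodWhere-paired zero {P} count≡0 _ = 0 , refl , ≈-reflexive (prodWhere-empty P N count≡0)
  prodWhere-paired (suc n) {P} count≡ pairs with member P N count≡
  ... | a , a<N , Pa with removePair pairs a<N Pa | n
  ...   | count₂≡ , _ , _ | zero with () ← trans (sym count≡) count₂≡
  ...   | count₂≡ , prod₂≈ , pairs₂ | suc n′
          with prodWhere-paired n′ (ℕ.suc-injective (ℕ.suc-injective (trans (sym count₂≡) count≡))) pairs₂
  ...     | k , n′≡k+k , prod≈ =
    suc k , cong suc (trans (cong suc n′≡k+k) (sym (ℕ.+-suc k k))) ,
    ≈-trans prod₂≈ (≈-trans (*-cong prod≈ (≈-refl {c})) (≈-reflexive (ℤ.*-comm (c ^ k) c)))

-- Pairing each y ∈ {1, …, p - 1} with c / y gives (p - 1)! ≡ c^((p-1)/2) for a non-square unit c, and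
-- (p - 1)! ≡ -c^((p-1)/2) for a square c = s², whose roots ±s are the fixed points; c = 1 is Wilson's theorem.
module EulerCriterion (q : ℕ) (p-prime : Prime (suc (suc (suc q)))) where

  open import Data.Integer using (-_)
  open import Data.Integer.Divisibility.Signed using (_∣_; divides; ∣ᵤ⇒∣; ∣⇒∣ᵤ)
  open import Data.Nat.Coprimality using (coprime?; coprime-Bézout; prime⇒coprime)
  open import Data.Nat.GCD using (module Bézout)

  open Bits
  open Counting

  p : ℕ
  p = suc (suc (suc q))

  open CongruenceModℕ p

  Unit : ℤ → Set
  Unit x = ¬ (+ p ∣ x)

  euclid : ∀ x y → + p ∣ x * y → + p ∣ x ⊎ + p ∣ y
  euclid x y p∣xy = Sum.map ∣ᵤ⇒∣ ∣ᵤ⇒∣ (euclidsLemma ℤ.∣ x ∣ ℤ.∣ y ∣ p-prime (subst (p ℕ.∣_) (ℤ.abs-* x y) (∣⇒∣ᵤ p∣xy)))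

  Unit-* : ∀ {x y} → Unit x → Unit y → Unit (x * y)
  Unit-* {x} {y} ux uy p∣xy = [ ux , uy ]′ (euclid x y p∣xy)

  Unit-≉0 : ∀ {x} → Unit x → ¬ x ≈ + 0
  Unit-≉0 ux x≈0 = ux (≈0⇒∣ x≈0)

  Unit-small : ∀ {x} → 0 < x → x < p → Unit (+ x)
  Unit-small 0<x x<p p∣x = ℕ.<⇒≱ x<p (ℕ.∣⇒≤ {{ℕ.>-nonZero 0<x}} (∣⇒∣ᵤ p∣x))

  *-cancelˡ : ∀ {a x y} → Unit a → a * x ≈ a * y → x ≈ y
  *-cancelˡ {a} {x} {y} ua (mk≈ p∣ax-ay) = [ ⊥-elim ∘ ua , mk≈ ]′ (euclid a (x - y) (subst (+ p ∣_) (identity a x y) p∣ax-ay))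
    where identity : ∀ a x y → a * x - a * y ≡ a * (x - y)
          identity = solve-∀

  -- opaque, since unfolding the gcd computation inside `inverse` makes unification very expensive
  opaque
    -- 0 on multiples of p (a junk value)
    inverse : ℕ → ℤ
    inverse y with coprime? p y
    ... | no _ = + 0
    ... | yes coprime with coprime-Bézout coprime
    ...   | Bézout.+- _ z _ = - + z
    ...   | Bézout.-+ _ z _ = + z

    *-inverse : ∀ {y} → 0 < y → y < p → + y * inverse y ≈ + 1
    *-inverse {y} 0<y y<p with coprime? p y
    ... | no ¬coprime = ⊥-elim (¬coprime (prime⇒coprime p-prime {{ℕ.>-nonZero 0<y}} y<p))
    ... | yes coprime with coprime-Bézout coprime
    ...   | Bézout.+- x z eq = mk≈ (divides (- + x) (begin
        + y * - + z - + 1      ≡⟨ identity (+ y) (+ z) ⟩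
        - (+ 1 + + z * + y)   ≡⟨ cong -_ (trans (cong (_+_ (+ 1)) (sym (ℤ.pos-* z y))) (cong +_ eq)) ⟩
        - (+ (x ℕ.* p))        ≡⟨ cong -_ (ℤ.pos-* x p) ⟩
        - (+ x * + p)          ≡⟨ ℤ.neg-distribˡ-* (+ x) (+ p) ⟩
        - + x * + p            ∎))
      where open ≡-Reasoning
            identity : ∀ y z → y * - z - + 1 ≡ - (+ 1 + z * y)
            identity = solve-∀
    ...   | Bézout.-+ x z eq = mk≈ (divides (+ x) (begin
        + y * + z - + 1        ≡⟨ cong (_- + 1) (trans (ℤ.*-comm (+ y) (+ z)) (sym (ℤ.pos-* z y))) ⟩
        + (z ℕ.* y) - + 1      ≡⟨ cong (λ n → + n - + 1) (sym eq) ⟩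
        + (1 ℕ.+ x ℕ.* p) - + 1 ≡⟨ cong (_- + 1) (cong (_+_ (+ 1)) (ℤ.pos-* x p)) ⟩
        + 1 + + x * + p - + 1  ≡⟨ identity (+ x * + p) ⟩
        + x * + p              ∎))
      where open ≡-Reasoning
            identity : ∀ n → + 1 + n - + 1 ≡ n
            identity = solve-∀

    quotient : ℤ → ℕ → ℕ
    quotient c y = (c * inverse y) ℤ.%ℕ p

    quotient-< : ∀ c y → quotient c y < p
    quotient-< c y = n%ℕd<d (c * inverse y) p

    *-quotient : ∀ c {y} → 0 < y → y < p → + y * + quotient c y ≈ c
    *-quotient c {y} 0<y y<p = begin
      + y * + quotient c y     ≈⟨ *-cong (≈-refl {+ y}) (≈-sym (≈-%ℕ (c * inverse y))) ⟩
      + y * (c * inverse y)    ≡⟨ identity (+ y) c (inverse y) ⟩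
      c * (+ y * inverse y)    ≈⟨ *-cong (≈-refl {c}) (*-inverse 0<y y<p) ⟩
      c * + 1                  ≡⟨ ℤ.*-identityʳ c ⟩
      c                        ∎
      where open ≈-Reasoning
            identity : ∀ y c i → y * (c * i) ≡ c * (y * i)
            identity = solve-∀

  quotient-unique : ∀ {c y z} → 0 < y → y < p → z < p → + y * + z ≈ c → quotient c y ≡ z
  quotient-unique {c} {y} 0<y y<p z<p yz≈c =
    ≈⇒≡ (quotient-< c y) z<p (*-cancelˡ (Unit-small 0<y y<p) (≈-trans (*-quotient c 0<y y<p) (≈-sym yz≈c)))

  quotient-pos : ∀ {c y} → Unit c → 0 < y → y < p → 0 < quotient c y
  quotient-pos {c} {y} uc 0<y y<p = ℕ.n≢0⇒n>0 λ quotient≡0 → Unit-≉0 uc (≈-trans (≈-sym (*-quotient c 0<y y<p))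
    (≈-reflexive (trans (cong (λ z → + y * + z) quotient≡0) (ℤ.*-zeroʳ (+ y)))))

  quotient-involutive : ∀ {c y} → Unit c → 0 < y → y < p → quotient c (quotient c y) ≡ y
  quotient-involutive {c} {y} uc 0<y y<p =
    quotient-unique (quotient-pos uc 0<y y<p) (quotient-< c y) y<p
      (≈-trans (≈-reflexive (ℤ.*-comm (+ quotient c y) (+ y))) (*-quotient c 0<y y<p))

  IsSquare : ℤ → Set
  IsSquare c = Σ[ s ∈ ℕ ] + s * + s ≈ c

  nonzero : ℕ → Bool
  nonzero x = not (x ≡ᵇ 0)

  nonzero⇒0< : ∀ {x} → nonzero x ≡ true → 0 < x
  nonzero⇒0< {suc x} _ = s≤s z≤n

  0<⇒nonzero : ∀ {x} → 0 < x → nonzero x ≡ true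
  0<⇒nonzero {suc x} _ = refl

  countWhere-nonzero : ∀ N → countWhere nonzero (suc N) ≡ N
  countWhere-nonzero zero    = refl
  countWhere-nonzero (suc N) = trans (cong (ℕ._+ 1) (countWhere-nonzero N)) (ℕ.+-comm N 1)

  factorial : ℤ
  factorial = prodWhere nonzero p

  open Pairing (+ p) p

  factorial-nonsquare : ∀ {c} → Unit c → ¬ IsSquare c → Σ[ k ∈ ℕ ] suc (suc q) ≡ k ℕ.+ k × factorial ≈ c ^ k
  factorial-nonsquare {c} uc nonsquare =
    prodWhere-paired (quotient c) c (suc (suc q)) (countWhere-nonzero (suc (suc q))) pairs
    where
      pairs : PairsOff (quotient c) c nonzero
      pairs {x} x<p nzx =
        quotient-< c x , 0<⇒nonzero (quotient-pos uc 0<x x<p) , quotient-involutive uc 0<x x<p ,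
        (λ fixed → nonsquare (x , ≈-trans (≈-reflexive (cong (λ z → + x * + z) (sym fixed))) (*-quotient c 0<x x<p))) ,
        *-quotient c 0<x x<p
        where 0<x = nonzero⇒0< nzx

  ∸≈- : ∀ {s} → s < p → + (p ℕ.∸ s) ≈ - + s
  ∸≈- {s} s<p = mk≈ (divides (+ 1) (begin
    + (p ℕ.∸ s) - - + s      ≡⟨ identity (+ (p ℕ.∸ s)) (+ s) ⟩
    + s + + (p ℕ.∸ s)        ≡⟨ sym (ℤ.pos-+ s (p ℕ.∸ s)) ⟩
    + (s ℕ.+ (p ℕ.∸ s))      ≡⟨ cong +_ (ℕ.m+[n∸m]≡n (ℕ.<⇒≤ s<p)) ⟩
    + p                      ≡⟨ sym (ℤ.*-identityˡ (+ p)) ⟩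
    + 1 * + p                ∎))
    where open ≡-Reasoning
          identity : ∀ a b → a - - b ≡ b + a
          identity = solve-∀

  ∸-< : ∀ {s} → 0 < s → s < p → p ℕ.∸ s < p
  ∸-< {s} 0<s s<p = ℕ.∸-monoʳ-< {p} {s} {0} 0<s (ℕ.<⇒≤ s<p)

  ∸≢ : ∀ {s} → s < p → p ℕ.∸ s ≢ s
  ∸≢ {s} s<p p∸s≡s = [ (λ ()) , (λ ()) ]′ (prime⇒irreducible p-prime 2∣p)
    where
      2∣p : 2 ℕ.∣ p
      2∣p = ℕ.divides s (begin
        p                    ≡⟨ ℕ.m+[n∸m]≡n (ℕ.<⇒≤ s<p) ⟨
        s ℕ.+ (p ℕ.∸ s)      ≡⟨ cong (s ℕ.+_) p∸s≡s ⟩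
        s ℕ.+ s              ≡⟨ cong (s ℕ.+_) (ℕ.+-identityʳ s) ⟨
        2 ℕ.* s              ≡⟨ ℕ.*-comm 2 s ⟩
        s ℕ.* 2              ∎)
        where open ≡-Reasoning

  private
    p∣[x-s][x+s] : ∀ {c s x} → + s * + s ≈ c → + x * + x ≈ c → + p ∣ (+ x - + s) * (+ x + + s)
    p∣[x-s][x+s] {c} {s} {x} ss≈c xx≈c = ≈0⇒∣ (begin
      (+ x - + s) * (+ x + + s)   ≡⟨ identity (+ x) (+ s) ⟩
      + x * + x - + s * + s       ≈⟨ +-cong xx≈c (neg-cong ss≈c) ⟩
      c - c                       ≡⟨ ℤ.+-inverseʳ c ⟩
      + 0                         ∎)
      where
        open ≈-Reasoning
        identity : ∀ x s → (x - s) * (x + s) ≡ x * x - s * s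
        identity = solve-∀

    root-s : ∀ {s x} → s < p → x < p → + p ∣ + x - + s → x ≡ s
    root-s {s} {x} s<p x<p p∣x-s = ≈⇒≡ x<p s<p (begin
      + x                  ≡⟨ identity (+ x) (+ s) ⟩
      (+ x - + s) + + s    ≈⟨ +-cong (∣⇒≈0 p∣x-s) (≈-refl {+ s}) ⟩
      + 0 + + s            ≡⟨ ℤ.+-identityˡ (+ s) ⟩
      + s                  ∎)
      where
        open ≈-Reasoning
        identity : ∀ x s → x ≡ (x - s) + s
        identity = solve-∀

    root-p∸s : ∀ {s x} → 0 < s → s < p → x < p → + p ∣ + x + + s → x ≡ p ℕ.∸ s
    root-p∸s {s} {x} 0<s s<p x<p p∣x+s = ≈⇒≡ x<p (∸-< 0<s s<p) (begin
      + x                  ≡⟨ identity (+ x) (+ s) ⟩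
      (+ x + + s) - + s    ≈⟨ +-cong (∣⇒≈0 p∣x+s) (≈-refl { - + s}) ⟩
      + 0 - + s            ≡⟨ ℤ.+-identityˡ (- + s) ⟩
      - + s                ≈⟨ ≈-sym (∸≈- s<p) ⟩
      + (p ℕ.∸ s)          ∎)
      where
        open ≈-Reasoning
        identity : ∀ x s → x ≡ (x + s) - s
        identity = solve-∀

  square-roots : ∀ {c s x} → 0 < s → s < p → + s * + s ≈ c → x < p → + x * + x ≈ c → x ≡ s ⊎ x ≡ p ℕ.∸ s
  square-roots {c} {s} {x} 0<s s<p ss≈c x<p xx≈c =
    Sum.map (root-s s<p x<p) (root-p∸s 0<s s<p x<p) (euclid (+ x - + s) (+ x + + s) (p∣[x-s][x+s] {c} {s} {x} ss≈c xx≈c))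

  private
    *-roots : ∀ {a b r c k} → a ≈ c ^ k → b ≈ - r → r * r ≈ c → a * b * r ≈ - (c ^ suc k)
    *-roots {a} {b} {r} {c} {k} a≈cᵏ b≈-r rr≈c = begin
      a * b * r              ≈⟨ *-cong (*-cong a≈cᵏ b≈-r) (≈-refl {r}) ⟩
      c ^ k * - r * r        ≡⟨ identity (c ^ k) r ⟩
      - (c ^ k * (r * r))    ≈⟨ neg-cong (*-cong (≈-refl {c ^ k}) rr≈c) ⟩
      - (c ^ k * c)          ≡⟨ cong -_ (ℤ.*-comm (c ^ k) c) ⟩
      - (c ^ suc k)          ∎
      where
        open ≈-Reasoning
        identity : ∀ a r → a * - r * r ≡ - (a * (r * r))
        identity = solve-∀

  module SquareCase {c : ℤ} {s : ℕ} (uc : Unit c) (0<s : 0 < s) (s<p : s < p) (ss≈c : + s * + s ≈ c) where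

    private
      s′s′≈c : + (p ℕ.∸ s) * + (p ℕ.∸ s) ≈ c
      s′s′≈c = ≈-trans (*-cong (∸≈- s<p) (∸≈- s<p)) (≈-trans (≈-reflexive (identity (+ s))) ss≈c)
        where identity : ∀ a → - a * - a ≡ a * a
              identity = solve-∀

      nonroot : ℕ → Bool
      nonroot = without (p ℕ.∸ s) (without s nonzero)

      quotient-fixes : ∀ {r} → 0 < r → r < p → + r * + r ≈ c → quotient c r ≡ r
      quotient-fixes 0<r r<p rr≈c = quotient-unique 0<r r<p r<p rr≈c

      pairs : PairsOff (quotient c) c nonroot
      pairs {x} x<p nonroot-x with without-true (without s nonzero) nonroot-x
      ... | nzx′ , x≢s′ with without-true nonzero nzx′
      ... | nzx , x≢s =
        quotient-< c x ,
        without-intro (without s nonzero)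
          (without-intro nonzero (0<⇒nonzero (quotient-pos uc 0<x x<p))
            (λ σx≡s → x≢s (trans (sym σσx≡x) (trans (cong (quotient c) σx≡s) (quotient-fixes 0<s s<p ss≈c)))))
          (λ σx≡s′ → x≢s′ (trans (sym σσx≡x) (trans (cong (quotient c) σx≡s′)
                                                (quotient-fixes (ℕ.m<n⇒0<n∸m s<p) (∸-< 0<s s<p) s′s′≈c)))) ,
        σσx≡x ,
        (λ fixed → [ x≢s , x≢s′ ]′ (square-roots 0<s s<p ss≈c x<p
                      (≈-trans (≈-reflexive (cong (λ z → + x * + z) (sym fixed))) (*-quotient c 0<x x<p)))) ,
        *-quotient c 0<x x<p
        where
          0<x = nonzero⇒0< nzx
          σσx≡x = quotient-involutive uc 0<x x<p

      nonzero-s′ : without s nonzero (p ℕ.∸ s) ≡ true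
      nonzero-s′ = without-intro nonzero (0<⇒nonzero (ℕ.m<n⇒0<n∸m s<p)) (∸≢ s<p)

      count≡ : suc (suc q) ≡ suc (suc (countWhere nonroot p))
      count≡ = begin
        suc (suc q)                                   ≡⟨ countWhere-nonzero (suc (suc q)) ⟨
        countWhere nonzero p                          ≡⟨ countWhere-without nonzero p s<p (0<⇒nonzero 0<s) ⟩
        suc (countWhere (without s nonzero) p)        ≡⟨ cong suc (countWhere-without (without s nonzero) p (∸-< 0<s s<p) nonzero-s′) ⟩
        suc (suc (countWhere nonroot p))              ∎
        where open ≡-Reasoning

      factorial≡ : factorial ≡ prodWhere nonroot p * + (p ℕ.∸ s) * + s
      factorial≡ = trans (prodWhere-without nonzero p s<p (0<⇒nonzero 0<s))
        (cong (_* + s) (prodWhere-without (without s nonzero) p (∸-< 0<s s<p) nonzero-s′))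

    factorial-square : Σ[ k ∈ ℕ ] suc (suc q) ≡ suc k ℕ.+ suc k × factorial ≈ - (c ^ suc k)
    factorial-square = conclude (prodWhere-paired (quotient c) c (countWhere nonroot p) refl pairs)
      where
        conclude : Σ[ k ∈ ℕ ] countWhere nonroot p ≡ k ℕ.+ k × prodWhere nonroot p ≈ c ^ k →
                   Σ[ k ∈ ℕ ] suc (suc q) ≡ suc k ℕ.+ suc k × factorial ≈ - (c ^ suc k)
        conclude (k , count≡k+k , prod≈) =
          k , trans count≡ (cong suc (trans (cong suc count≡k+k) (sym (ℕ.+-suc k k)))) ,
          ≈-trans (≈-reflexive factorial≡) (*-roots {k = k} prod≈ (∸≈- s<p) ss≈c)

  private
    unit-square : Σ[ k ∈ ℕ ] suc (suc q) ≡ suc k ℕ.+ suc k × factorial ≈ - ((+ 1) ^ suc k)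
    unit-square = SquareCase.factorial-square {+ 1} {1} (Unit-small (s≤s z≤n) (s≤s (s≤s z≤n)))
                    (s≤s z≤n) (s≤s (s≤s z≤n)) ≈-refl

  -- that p - 1 is even falls out of pairing {2, …, p - 2} by inversion
  half : ℕ
  half = suc (proj₁ unit-square)

  half-spec : suc (suc q) ≡ half ℕ.+ half
  half-spec = proj₁ (proj₂ unit-square)

  wilson : factorial ≈ - + 1
  wilson = ≈-trans (proj₂ (proj₂ unit-square)) (≈-reflexive (cong -_ (ℤ.^-zeroˡ half)))

  square-root-reduced : ∀ {c} → Unit c → IsSquare c → Σ[ s ∈ ℕ ] 0 < s × s < p × + s * + s ≈ c
  square-root-reduced {c} uc (y , yy≈c) with y ℕ.% p in y%p≡
  ... | zero  = ⊥-elim (Unit-≉0 uc (≈-trans (≈-sym yy≈c) (≈-trans (*-cong y≈ y≈) (≈-refl {+ 0}))))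
    where y≈ : + y ≈ + 0
          y≈ = ≈-trans (≈-%ℕ (+ y)) (≈-reflexive (cong +_ y%p≡))
  ... | suc s = suc s , s≤s z≤n , subst (_< p) y%p≡ (ℕ.m%n<n y p) , ≈-trans (*-cong y≈ y≈) yy≈c
    where y≈ : + suc s ≈ + y
          y≈ = ≈-sym (≈-trans (≈-%ℕ (+ y)) (≈-reflexive (cong +_ y%p≡)))

  neg-injective : ∀ {a b} → - a ≈ - b → a ≈ b
  neg-injective {a} {b} -a≈-b =
    ≈-trans (≈-reflexive (sym (ℤ.neg-involutive a))) (≈-trans (neg-cong -a≈-b) (≈-reflexive (ℤ.neg-involutive b)))

  private
    half≡ : ∀ {k} → suc (suc q) ≡ k ℕ.+ k → half ≡ k
    half≡ p∸1≡k+k = double-injective {half} (trans (sym half-spec) p∸1≡k+k)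

  euler-square : ∀ {c} → Unit c → IsSquare c → c ^ half ≈ + 1
  euler-square {c} uc square = conclude (square-root-reduced uc square)
    where
      from-factorial : Σ[ k ∈ ℕ ] suc (suc q) ≡ suc k ℕ.+ suc k × factorial ≈ - (c ^ suc k) → c ^ half ≈ + 1
      from-factorial (k , p∸1≡ , factorial≈) =
        subst (λ h → c ^ h ≈ + 1) (sym (half≡ {suc k} p∸1≡)) (neg-injective (≈-trans (≈-sym factorial≈) wilson))
      conclude : Σ[ s ∈ ℕ ] 0 < s × s < p × + s * + s ≈ c → c ^ half ≈ + 1
      conclude (s , 0<s , s<p , ss≈c) = from-factorial (SquareCase.factorial-square uc 0<s s<p ss≈c)

  euler-nonsquare : ∀ {c} → Unit c → ¬ IsSquare c → c ^ half ≈ - + 1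
  euler-nonsquare {c} uc nonsquare = conclude (factorial-nonsquare uc nonsquare)
    where
      conclude : Σ[ k ∈ ℕ ] suc (suc q) ≡ k ℕ.+ k × factorial ≈ c ^ k → c ^ half ≈ - + 1
      conclude (k , p∸1≡ , factorial≈) =
        subst (λ h → c ^ h ≈ - + 1) (sym (half≡ {k} p∸1≡)) (≈-trans (≈-sym factorial≈) wilson)

module LegendreSymbol (q : ℕ) (p-prime : Prime (suc (suc (suc q)))) where

  open import Data.Integer using (-_)
  open import Data.Integer.Divisibility.Signed using (_∣_; ∣⇒∣ᵤ; ∣m⇒∣-m)
  open import Data.Bool.Properties using (T-≡)
  open import Data.Bool.ListAction using (any)
  open import Data.List using (upTo)
  open import Data.List.Relation.Unary.Any using (Any; satisfied)
  open import Data.List.Relation.Unary.Any.Properties using (any⁺; any⁻)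
  open import Data.List.Membership.Propositional using (lose)
  open import Data.List.Membership.Propositional.Properties using (∈-upTo⁺)
  open import Function.Bundles using (Equivalence)

  open Bits
  open EulerCriterion q p-prime
  open CongruenceModℕ p

  private
    squares-to : ℤ → ℕ → Bool
    squares-to x y = (y ℕ.* y) ℕ.% p ≡ᵇ x ℤ.%ℕ p

    any-squares-to : ∀ {x} → legBit q x ≡ false → T (any (squares-to x) (upTo p))
    any-squares-to {x} eq with any (squares-to x) (upTo p) | eq
    ... | true | _ = _

  legBit≡false⇒square : ∀ {x} → legBit q x ≡ false → IsSquare x
  legBit≡false⇒square {x} eq with satisfied (any⁻ (squares-to x) (upTo p) (any-squares-to {x} eq))
  ... | y , T[y²≡x] = y , (begin
    + y * + y                ≡⟨ ℤ.pos-* y y ⟨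
    + (y ℕ.* y)              ≈⟨ ≈-%ℕ (+ (y ℕ.* y)) ⟩
    + ((y ℕ.* y) ℕ.% p)      ≡⟨ cong +_ (ℕ.≡ᵇ⇒≡ _ _ T[y²≡x]) ⟩
    + (x ℤ.%ℕ p)             ≈⟨ ≈-%ℕ x ⟨
    x                        ∎)
    where open ≈-Reasoning

  square⇒legBit≡false : ∀ {x} → IsSquare x → legBit q x ≡ false
  square⇒legBit≡false {x} (y , yy≈x) = cong not (Equivalence.to T-≡ (any⁺ (squares-to x) y′-squares-to-x))
    where
      y′ = y ℕ.% p
      y′≈y : + y′ ≈ + y
      y′≈y = ≈-sym (≈-%ℕ (+ y))
      y′y′≈x : + (y′ ℕ.* y′) ≈ x
      y′y′≈x = ≈-trans (≈-reflexive (ℤ.pos-* y′ y′)) (≈-trans (*-cong y′≈y y′≈y) yy≈x)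
      y′-squares-to-x : Any (T ∘ squares-to x) (upTo p)
      y′-squares-to-x = lose (∈-upTo⁺ (ℕ.m%n<n y p)) (ℕ.≡⇒≡ᵇ _ _ (≈⇒%ℕ≡ y′y′≈x))

  euler-criterion : ∀ {c} → Unit c → c ^ half ≈ sgn (legBit q c)
  euler-criterion {c} uc = by-cases (legBit q c) refl
    where
      by-cases : ∀ b → legBit q c ≡ b → c ^ half ≈ sgn b
      by-cases true  eq = euler-nonsquare uc λ square → case trans (sym eq) (square⇒legBit≡false {c} square) of λ ()
      by-cases false eq = euler-square uc (legBit≡false⇒square {c} eq)

  private
    1≉-1 : ¬ + 1 ≈ - + 1
    1≉-1 (mk≈ p∣2) = ℕ.>⇒∤ (s≤s (s≤s (s≤s z≤n))) (∣⇒∣ᵤ p∣2)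

  sgn-injective : ∀ a b → sgn a ≈ sgn b → a ≡ b
  sgn-injective true  true  _    = refl
  sgn-injective false false _    = refl
  sgn-injective true  false -1≈1 = ⊥-elim (1≉-1 (≈-sym -1≈1))
  sgn-injective false true  1≈-1 = ⊥-elim (1≉-1 1≈-1)

  private
    ^-distrib-* : ∀ x y n → (x * y) ^ n ≡ x ^ n * y ^ n
    ^-distrib-* x y zero    = refl
    ^-distrib-* x y (suc n) = trans (cong ((x * y) *_) (^-distrib-* x y n)) (identity x y (x ^ n) (y ^ n))
      where identity : ∀ x y a b → x * y * (a * b) ≡ x * a * (y * b)
            identity = solve-∀

  legBit-* : ∀ {x y} → Unit x → Unit y → legBit q (x * y) ≡ legBit q x xor legBit q y
  legBit-* {x} {y} ux uy = sgn-injective (legBit q (x * y)) (legBit q x xor legBit q y) (begin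
    sgn (legBit q (x * y))                    ≈⟨ euler-criterion (Unit-* ux uy) ⟨
    (x * y) ^ half                            ≡⟨ ^-distrib-* x y half ⟩
    x ^ half * y ^ half                       ≈⟨ *-cong (euler-criterion ux) (euler-criterion uy) ⟩
    sgn (legBit q x) * sgn (legBit q y)       ≡⟨ sgn-xor (legBit q x) (legBit q y) ⟨
    sgn (legBit q x xor legBit q y)           ∎)
    where open ≈-Reasoning

  legBit-1 : legBit q (+ 1) ≡ false
  legBit-1 = square⇒legBit≡false {+ 1} (1 , ≈-refl)

  legBit-neg1 : legBit q (- + 1) ≡ ((suc (suc q) ℕ./ 2) ℕ.% 2 ≡ᵇ 1)
  legBit-neg1 = begin
    legBit q (- + 1)
      ≡⟨ sgn-injective (legBit q (- + 1)) (odd half)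
           (≈-trans (≈-sym (euler-criterion unit)) (≈-reflexive (-1^≡sgn∘odd half))) ⟩
    odd half
      ≡⟨ odd≡%2≡ᵇ1 half ⟩
    half ℕ.% 2 ≡ᵇ 1
      ≡⟨ cong (λ n → n ℕ.% 2 ≡ᵇ 1) half≡ ⟨
    (suc (suc q) ℕ./ 2) ℕ.% 2 ≡ᵇ 1 ∎
    where
      open ≡-Reasoning
      unit : Unit (- + 1)
      unit p∣-1 = Unit-small (s≤s z≤n) (s≤s (s≤s z≤n)) (∣m⇒∣-m p∣-1)
      half≡ : suc (suc q) ℕ./ 2 ≡ half
      half≡ = trans (cong (ℕ._/ 2) (trans half-spec (trans (cong (half ℕ.+_) (sym (ℕ.+-identityʳ half))) (ℕ.*-comm 2 half))))
                    (ℕ.m*n/n≡m half 2)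

module Valuation (q : ℕ) where

  open import Algebra.Properties.CommutativeSemigroup ℕ.*-commutativeSemigroup using (interchange)

  p : ℕ
  p = suc (suc q)

  private
    ≡ᵇ0⇒≡0 : ∀ {x} → (x ≡ᵇ 0) ≡ true → x ≡ 0
    ≡ᵇ0⇒≡0 {zero} _ = refl

  p^valℕ*stripℕ : ∀ k x → p ℕ.^ valℕ q k x ℕ.* stripℕ q k x ≡ x
  p^valℕ*stripℕ zero    x = ℕ.+-identityʳ x
  p^valℕ*stripℕ (suc k) x with x ≡ᵇ 0 in x≡ᵇ0
  ... | true  = sym (≡ᵇ0⇒≡0 x≡ᵇ0)
  ... | false with x ℕ.% p ≡ᵇ 0 in x%p≡ᵇ0
  ...   | false = ℕ.+-identityʳ x
  ...   | true  = begin
    p ℕ.* p ℕ.^ valℕ q k (x ℕ./ p) ℕ.* stripℕ q k (x ℕ./ p)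
      ≡⟨ ℕ.*-assoc p (p ℕ.^ valℕ q k (x ℕ./ p)) (stripℕ q k (x ℕ./ p)) ⟩
    p ℕ.* (p ℕ.^ valℕ q k (x ℕ./ p) ℕ.* stripℕ q k (x ℕ./ p))
      ≡⟨ cong (p ℕ.*_) (p^valℕ*stripℕ k (x ℕ./ p)) ⟩
    p ℕ.* (x ℕ./ p)
      ≡⟨ ℕ.m*[n/m]≡n (ℕ.m%n≡0⇒n∣m x p (≡ᵇ0⇒≡0 x%p≡ᵇ0)) ⟩
    x ∎
    where open ≡-Reasoning

  stripℕ-coprime : ∀ k x → 0 < x → x ≤ k → ¬ p ℕ.∣ stripℕ q k x
  stripℕ-coprime zero    (suc x) _ ()
  stripℕ-coprime (suc k) x 0<x x≤1+k with x ≡ᵇ 0 in x≡ᵇ0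
  ... | true  = ⊥-elim (ℕ.<⇒≢ 0<x (sym (≡ᵇ0⇒≡0 x≡ᵇ0)))
  ... | false with x ℕ.% p ≡ᵇ 0 in x%p≡ᵇ0
  ...   | false = λ p∣x → case trans (sym x%p≡ᵇ0) (cong (_≡ᵇ 0) (ℕ.n∣m⇒m%n≡0 x p p∣x)) of λ ()
  ...   | true  = stripℕ-coprime k (x ℕ./ p) 0<x/p (ℕ.≤-pred (ℕ.≤-trans x/p<x x≤1+k))
    where
      p∣x : p ℕ.∣ x
      p∣x = ℕ.m%n≡0⇒n∣m x p (≡ᵇ0⇒≡0 x%p≡ᵇ0)
      x/p<x : x ℕ./ p < x
      x/p<x = ℕ.m/n<m x p {{ℕ.>-nonZero 0<x}} (s≤s (s≤s z≤n))
      0<x/p : 0 < x ℕ./ p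
      0<x/p = ℕ.m≥n⇒m/n>0 (ℕ.∣⇒≤ {{ℕ.>-nonZero 0<x}} p∣x)

  p^*-unique : ∀ a b {s t} → ¬ p ℕ.∣ s → ¬ p ℕ.∣ t → p ℕ.^ a ℕ.* s ≡ p ℕ.^ b ℕ.* t → a ≡ b × s ≡ t
  p^*-unique zero    zero    _ _ eq = refl , trans (sym (ℕ.+-identityʳ _)) (trans eq (ℕ.+-identityʳ _))
  p^*-unique zero    (suc b) {s} {t} p∤s _ eq = ⊥-elim (p∤s (ℕ.divides (p ℕ.^ b ℕ.* t) (begin
    s                        ≡⟨ ℕ.+-identityʳ s ⟨
    1 ℕ.* s                  ≡⟨ eq ⟩
    p ℕ.* p ℕ.^ b ℕ.* t      ≡⟨ ℕ.*-assoc p (p ℕ.^ b) t ⟩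
    p ℕ.* (p ℕ.^ b ℕ.* t)    ≡⟨ ℕ.*-comm p (p ℕ.^ b ℕ.* t) ⟩
    p ℕ.^ b ℕ.* t ℕ.* p      ∎)))
    where open ≡-Reasoning
  p^*-unique (suc a) zero    p∤s p∤t eq with p^*-unique zero (suc a) p∤t p∤s (sym eq)
  ... | () , _
  p^*-unique (suc a) (suc b) {s} {t} p∤s p∤t eq with p^*-unique a b p∤s p∤t
    (ℕ.*-cancelˡ-≡ _ _ p (trans (sym (ℕ.*-assoc p (p ℕ.^ a) s)) (trans eq (ℕ.*-assoc p (p ℕ.^ b) t))))
  ... | a≡b , s≡t = cong suc a≡b , s≡t

  val : ℕ → ℕ
  val x = valℕ q x x

  unitPart : ℕ → ℕ
  unitPart x = stripℕ q x x

  p^val*unitPart : ∀ x → p ℕ.^ val x ℕ.* unitPart x ≡ x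
  p^val*unitPart x = p^valℕ*stripℕ x x

  unitPart-coprime : ∀ {x} → 0 < x → ¬ p ℕ.∣ unitPart x
  unitPart-coprime {x} 0<x = stripℕ-coprime x x 0<x ℕ.≤-refl

  module _ (p-prime : Prime p) where

    val-unitPart-* : ∀ {x y} → 0 < x → 0 < y →
      val (x ℕ.* y) ≡ val x ℕ.+ val y × unitPart (x ℕ.* y) ≡ unitPart x ℕ.* unitPart y
    val-unitPart-* {x} {y} 0<x 0<y =
      p^*-unique (val (x ℕ.* y)) (val x ℕ.+ val y) (unitPart-coprime (ℕ.*-mono-< 0<x 0<y)) p∤uxuy (begin
        p ℕ.^ val (x ℕ.* y) ℕ.* unitPart (x ℕ.* y)
          ≡⟨ p^val*unitPart (x ℕ.* y) ⟩
        x ℕ.* y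
          ≡⟨ cong₂ ℕ._*_ (p^val*unitPart x) (p^val*unitPart y) ⟨
        (p ℕ.^ val x ℕ.* unitPart x) ℕ.* (p ℕ.^ val y ℕ.* unitPart y)
          ≡⟨ interchange (p ℕ.^ val x) (unitPart x) (p ℕ.^ val y) (unitPart y) ⟩
        (p ℕ.^ val x ℕ.* p ℕ.^ val y) ℕ.* (unitPart x ℕ.* unitPart y)
          ≡⟨ cong (ℕ._* (unitPart x ℕ.* unitPart y)) (ℕ.^-distribˡ-+-* p (val x) (val y)) ⟨
        p ℕ.^ (val x ℕ.+ val y) ℕ.* (unitPart x ℕ.* unitPart y) ∎)
      where
        open ≡-Reasoning
        p∤uxuy : ¬ p ℕ.∣ unitPart x ℕ.* unitPart y
        p∤uxuy p∣uxuy = [ unitPart-coprime 0<x , unitPart-coprime 0<y ]′ (euclidsLemma _ _ p-prime p∣uxuy)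

module Characters where

  open import Data.Bool.Properties using (xor-identityʳ)
  open import Data.Integer using (-[1+_]; +[1+_])
  open import Data.Integer.GCD using (gcd)
  open Bits using (xor-cancel-common; xor-interchange)

  IsℤCharacter : (ℤ → Bool) → Set
  IsℤCharacter h = ∀ x y → x ≢ + 0 → y ≢ + 0 → h (x * y) ≡ h x xor h y

  IsCharacter : (ℚ → Bool) → Set
  IsCharacter χ = ∀ a b → a ≢ 0ℚ → b ≢ 0ℚ → χ (a ℚ.* b) ≡ χ a xor χ b

  onFraction : (ℤ → Bool) → ℚ → Bool
  onFraction h a = h (↥ a) xor h (↧ a)

  private
    ↥≢0 : ∀ {a} → a ≢ 0ℚ → ↥ a ≢ + 0
    ↥≢0 {a} a≢0 ↥a≡0 = a≢0 (ℚ.↥p≡0⇒p≡0 a ↥a≡0)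

    *≢0 : ∀ {x y} → x ≢ + 0 → y ≢ + 0 → x * y ≢ + 0
    *≢0 {x} x≢0 y≢0 xy≡0 = [ x≢0 , y≢0 ]′ (ℤ.i*j≡0⇒i≡0∨j≡0 x xy≡0)

    ≢0-factors : ∀ {x y} → x * y ≢ + 0 → x ≢ + 0 × y ≢ + 0
    ≢0-factors {x} {y} xy≢0 =
      (λ x≡0 → xy≢0 (trans (cong (_* y) x≡0) (ℤ.*-zeroˡ y))) ,
      (λ y≡0 → xy≢0 (trans (cong (x *_) y≡0) (ℤ.*-zeroʳ x)))

  -- ↥ (a * b) and ↧ (a * b) are ↥ a * ↥ b and ↧ a * ↧ b divided by their gcd c, whose value h c cancels
  onFraction-isCharacter : ∀ {h} → IsℤCharacter h → IsCharacter (onFraction h)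
  onFraction-isCharacter {h} h-* a@record{} b@record{} a≢0 b≢0 = begin
    h (↥ ab) xor h (↧ ab)                             ≡⟨ xor-cancel-common (h (↥ ab)) (h (↧ ab)) (h c) ⟨
    (h (↥ ab) xor h c) xor (h (↧ ab) xor h c)         ≡⟨ cong₂ _xor_ numerator denominator ⟩
    (h (↥ a) xor h (↥ b)) xor (h (↧ a) xor h (↧ b))   ≡⟨ xor-interchange (h (↥ a)) (h (↥ b)) (h (↧ a)) (h (↧ b)) ⟩
    (h (↥ a) xor h (↧ a)) xor (h (↥ b) xor h (↧ b))   ∎
    where
      open ≡-Reasoning
      ab = a ℚ.* b
      N = ↥ a * ↥ b
      D = ↧ₙ a ℕ.* ↧ₙ b
      c = gcd N (+ D)
      ↥ab*c≢0 : ↥ ab * c ≢ + 0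
      ↥ab*c≢0 = subst (_≢ + 0) (sym (ℚ.↥-/ N D)) (*≢0 (↥≢0 a≢0) (↥≢0 b≢0))
      numerator : h (↥ ab) xor h c ≡ h (↥ a) xor h (↥ b)
      numerator = begin
        h (↥ ab) xor h c       ≡⟨ h-* (↥ ab) c (proj₁ (≢0-factors {↥ ab} {c} ↥ab*c≢0)) (proj₂ (≢0-factors {↥ ab} {c} ↥ab*c≢0)) ⟨
        h (↥ ab * c)           ≡⟨ cong h (ℚ.↥-/ N D) ⟩
        h N                    ≡⟨ h-* (↥ a) (↥ b) (↥≢0 a≢0) (↥≢0 b≢0) ⟩
        h (↥ a) xor h (↥ b)    ∎
      denominator : h (↧ ab) xor h c ≡ h (↧ a) xor h (↧ b)
      denominator = begin
        h (↧ ab) xor h c       ≡⟨ h-* (↧ ab) c (λ ()) (proj₂ (≢0-factors {↥ ab} {c} ↥ab*c≢0)) ⟨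
        h (↧ ab * c)           ≡⟨ cong h (trans (ℚ.↧-/ N D) (ℤ.pos-* (↧ₙ a) (↧ₙ b))) ⟩
        h (↧ a * ↧ b)          ≡⟨ h-* (↧ a) (↧ b) (λ ()) (λ ()) ⟩
        h (↧ a) xor h (↧ b)    ∎

  isNeg-isℤCharacter : IsℤCharacter isNeg
  isNeg-isℤCharacter (+ zero)   _          x≢0 _   = ⊥-elim (x≢0 refl)
  isNeg-isℤCharacter _          (+ zero)   _   y≢0 = ⊥-elim (y≢0 refl)
  isNeg-isℤCharacter +[1+ m ]   +[1+ n ]   _   _   = refl
  isNeg-isℤCharacter +[1+ m ]   -[1+ n ]   _   _   = refl
  isNeg-isℤCharacter -[1+ m ]   +[1+ n ]   _   _   = refl
  isNeg-isℤCharacter -[1+ m ]   -[1+ n ]   _   _   = refl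

  isNeg∘↥-isCharacter : IsCharacter (isNeg ∘ ↥_)
  isNeg∘↥-isCharacter a b a≢0 b≢0 = begin
    isNeg (↥ (a ℚ.* b))                        ≡⟨ xor-identityʳ (isNeg (↥ (a ℚ.* b))) ⟨
    onFraction isNeg (a ℚ.* b)                 ≡⟨ onFraction-isCharacter {isNeg} isNeg-isℤCharacter a b a≢0 b≢0 ⟩
    onFraction isNeg a xor onFraction isNeg b  ≡⟨ cong₂ _xor_ (xor-identityʳ (isNeg (↥ a))) (xor-identityʳ (isNeg (↥ b))) ⟩
    isNeg (↥ a) xor isNeg (↥ b)                ∎
    where open ≡-Reasoning

module CharactersAtPrime (q : ℕ) (p-prime : Prime (suc (suc q))) where

  open import Data.Integer using (sign; _◃_)
  open import Data.Integer.Divisibility.Signed using (∣⇒∣ᵤ) renaming (_∣_ to _∣ℤ_)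
  import Data.Sign.Base as Sign
  open Bits
  open Valuation q
  open Characters

  private
    ∣∣-pos : ∀ {x} → x ≢ + 0 → 0 < ℤ.∣ x ∣
    ∣∣-pos {x} x≢0 = ℕ.n≢0⇒n>0 (x≢0 ∘ ℤ.∣i∣≡0⇒i≡0)

  valParity : ℤ → Bool
  valParity x = odd (val ℤ.∣ x ∣)

  valParity-isℤCharacter : IsℤCharacter valParity
  valParity-isℤCharacter x y x≢0 y≢0 = begin
    odd (val ℤ.∣ x * y ∣)                    ≡⟨ cong (odd ∘ val) (ℤ.abs-* x y) ⟩
    odd (val (ℤ.∣ x ∣ ℕ.* ℤ.∣ y ∣))          ≡⟨ cong odd (proj₁ (val-unitPart-* p-prime (∣∣-pos x≢0) (∣∣-pos y≢0))) ⟩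
    odd (val ℤ.∣ x ∣ ℕ.+ val ℤ.∣ y ∣)        ≡⟨ odd-+ (val ℤ.∣ x ∣) (val ℤ.∣ y ∣) ⟩
    odd (val ℤ.∣ x ∣) xor odd (val ℤ.∣ y ∣)  ∎
    where open ≡-Reasoning

  oddVal-isCharacter : IsCharacter (oddVal q)
  oddVal-isCharacter a b a≢0 b≢0 = begin
    oddVal q (a ℚ.* b)                                 ≡⟨ oddVal≡ (a ℚ.* b) ⟩
    onFraction valParity (a ℚ.* b)                     ≡⟨ onFraction-isCharacter {valParity} valParity-isℤCharacter a b a≢0 b≢0 ⟩
    onFraction valParity a xor onFraction valParity b  ≡⟨ cong₂ _xor_ (oddVal≡ a) (oddVal≡ b) ⟨
    oddVal q a xor oddVal q b                          ∎
    where
      open ≡-Reasoning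
      oddVal≡ : ∀ a → oddVal q a ≡ onFraction valParity a
      oddVal≡ a = trans (sym (odd≡%2≡ᵇ1 (val ℤ.∣ ↥ a ∣ ℕ.+ val (↧ₙ a)))) (odd-+ (val ℤ.∣ ↥ a ∣) (val (↧ₙ a)))

  PUnit : ℤ → Set
  PUnit x = ¬ (+ p ∣ℤ x)

  unitPartℤ : ℤ → ℤ
  unitPartℤ x = sign x ◃ unitPart ℤ.∣ x ∣

  unitPartℤ-PUnit : ∀ {x} → x ≢ + 0 → PUnit (unitPartℤ x)
  unitPartℤ-PUnit {x} x≢0 p∣u = unitPart-coprime (∣∣-pos x≢0)
    (subst (p ℕ.∣_) (ℤ.abs-◃ (sign x) (unitPart ℤ.∣ x ∣)) (∣⇒∣ᵤ p∣u))

  unitPartℤ-* : ∀ x y → x ≢ + 0 → y ≢ + 0 → unitPartℤ (x * y) ≡ unitPartℤ x * unitPartℤ y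
  unitPartℤ-* x y x≢0 y≢0 = begin
    sign (x * y) ◃ unitPart ℤ.∣ x * y ∣
      ≡⟨ cong₂ _◃_ sign-xy (cong unitPart (ℤ.abs-* x y)) ⟩
    (sign x Sign.* sign y) ◃ unitPart (ℤ.∣ x ∣ ℕ.* ℤ.∣ y ∣)
      ≡⟨ cong ((sign x Sign.* sign y) ◃_) (proj₂ (val-unitPart-* p-prime (∣∣-pos x≢0) (∣∣-pos y≢0))) ⟩
    (sign x Sign.* sign y) ◃ (unitPart ℤ.∣ x ∣ ℕ.* unitPart ℤ.∣ y ∣)
      ≡⟨ ℤ.◃-distrib-* (sign x) (sign y) (unitPart ℤ.∣ x ∣) (unitPart ℤ.∣ y ∣) ⟩
    unitPartℤ x * unitPartℤ y ∎
    where
      open ≡-Reasoning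
      sign-xy : sign (x * y) ≡ sign x Sign.* sign y
      sign-xy = ℤ.sign-* x y {{ℤ.i*j≢0 x y {{ℤ.≢-nonZero x≢0}} {{ℤ.≢-nonZero y≢0}}}}

  unitCharacter : (ℤ → Bool) → ℚ → Bool
  unitCharacter g a = g (unitNum q a) xor g (unitDen q a)

  unitCharacter-isCharacter : ∀ {g} → (∀ {x y} → PUnit x → PUnit y → g (x * y) ≡ g x xor g y) →
    IsCharacter (unitCharacter g)
  unitCharacter-isCharacter {g} g-* a b a≢0 b≢0 = begin
    unitCharacter g (a ℚ.* b)                                      ≡⟨ unitCharacter≡ (a ℚ.* b) ⟩
    onFraction (g ∘ unitPartℤ) (a ℚ.* b)                           ≡⟨ onFraction-isCharacter {g ∘ unitPartℤ} g∘unitPartℤ-* a b a≢0 b≢0 ⟩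
    onFraction (g ∘ unitPartℤ) a xor onFraction (g ∘ unitPartℤ) b  ≡⟨ cong₂ _xor_ (unitCharacter≡ a) (unitCharacter≡ b) ⟨
    unitCharacter g a xor unitCharacter g b                        ∎
    where
      open ≡-Reasoning
      g∘unitPartℤ-* : IsℤCharacter (g ∘ unitPartℤ)
      g∘unitPartℤ-* x y x≢0 y≢0 = trans (cong g (unitPartℤ-* x y x≢0 y≢0)) (g-* (unitPartℤ-PUnit x≢0) (unitPartℤ-PUnit y≢0))
      unitCharacter≡ : ∀ a → unitCharacter g a ≡ onFraction (g ∘ unitPartℤ) a
      unitCharacter≡ a = cong (λ d → g (unitNum q a) xor g d) (sym (ℤ.+◃n≡+n (unitPart (↧ₙ a))))

module OddResiduesMod8 where

  open import Data.Bool using (_∨_)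
  open import Data.Bool.Properties using () renaming (_≟_ to _≟ᴮ_)
  open import Data.Bool.ListAction using (all)
  open import Data.List using (List; []; _∷_)
  open import Data.List.Membership.Propositional using (_∈_)
  open import Data.List.Relation.Unary.Any using (here; there)
  open import Data.List.Relation.Unary.All using (lookup)
  open import Data.List.Relation.Unary.All.Properties using (all⁺)
  open import Relation.Nullary.Decidable using (isYes; toWitness)
  open import Data.Integer.Divisibility.Signed using (_∣_; divides; ∣ᵤ⇒∣; ∣m∣n⇒∣m+n; ∣n⇒∣m*n)
  open CongruenceModℕ 8

  oddResidues : List ℕ
  oddResidues = 1 ∷ 3 ∷ 5 ∷ 7 ∷ []

  all-pairs : ∀ (P : ℕ → ℕ → Bool) → T (all (λ r → all (P r) oddResidues) oddResidues) →
    ∀ {r s} → r ∈ oddResidues → s ∈ oddResidues → T (P r s)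
  all-pairs P check {r} r∈ s∈ =
    lookup (all⁺ (P r) oddResidues (lookup (all⁺ (λ r → all (P r) oddResidues) oddResidues check) r∈)) s∈

  residue-odd : ∀ {x} → ¬ + 2 ∣ x → x ℤ.%ℕ 8 ∈ oddResidues
  residue-odd {x} 2∤x = below-8 (n%ℕd<d x 8) λ 2∣r → 2∤x (subst (+ 2 ∣_) (sym (a≡a%ℕn+[a/ℕn]*n x 8))
                          (∣m∣n⇒∣m+n (∣ᵤ⇒∣ {+ 2} {+ (x ℤ.%ℕ 8)} 2∣r) (∣n⇒∣m*n {+ 2} (x ℤ./ℕ 8) {+ 8} (divides (+ 4) refl))))
    where
      below-8 : ∀ {r} → r < 8 → ¬ 2 ℕ.∣ r → r ∈ oddResidues
      below-8 {0} _ 2∤r = ⊥-elim (2∤r (ℕ.divides 0 refl))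
      below-8 {1} _ _   = here refl
      below-8 {2} _ 2∤r = ⊥-elim (2∤r (ℕ.divides 1 refl))
      below-8 {3} _ _   = there (here refl)
      below-8 {4} _ 2∤r = ⊥-elim (2∤r (ℕ.divides 2 refl))
      below-8 {5} _ _   = there (there (here refl))
      below-8 {6} _ 2∤r = ⊥-elim (2∤r (ℕ.divides 3 refl))
      below-8 {7} _ _   = there (there (there (here refl)))
      below-8 {suc (suc (suc (suc (suc (suc (suc (suc _)))))))} (s≤s (s≤s (s≤s (s≤s (s≤s (s≤s (s≤s (s≤s ())))))))) _

  %ℕ8-* : ∀ x y → (x * y) ℤ.%ℕ 8 ≡ ((x ℤ.%ℕ 8) ℕ.* (y ℤ.%ℕ 8)) ℕ.% 8
  %ℕ8-* x y = ≈⇒%ℕ≡ (≈-trans (*-cong (≈-%ℕ x) (≈-%ℕ y)) (≈-reflexive (sym (ℤ.pos-* (x ℤ.%ℕ 8) (y ℤ.%ℕ 8)))))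

  module _ (χ : ℕ → Bool)
           (check : T (all (λ r → all (λ s → isYes (χ ((r ℕ.* s) ℕ.% 8) ≟ᴮ (χ r xor χ s))) oddResidues) oddResidues)) where

    residueCharacter-* : ∀ {x y} → ¬ + 2 ∣ x → ¬ + 2 ∣ y → χ ((x * y) ℤ.%ℕ 8) ≡ χ (x ℤ.%ℕ 8) xor χ (y ℤ.%ℕ 8)
    residueCharacter-* {x} {y} 2∤x 2∤y = trans (cong χ (%ℕ8-* x y))
      (toWitness {a? = χ ((r ℕ.* s) ℕ.% 8) ≟ᴮ (χ r xor χ s)}
        (all-pairs (λ r s → isYes (χ ((r ℕ.* s) ℕ.% 8) ≟ᴮ (χ r xor χ s))) check (residue-odd 2∤x) (residue-odd 2∤y)))
      where
        r = x ℤ.%ℕ 8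
        s = y ℤ.%ℕ 8

  -- the last argument, a check of the multiplication table mod 8, reduces to ⊤
  epsBit-* : ∀ {x y} → ¬ + 2 ∣ x → ¬ + 2 ∣ y → epsBit (x * y) ≡ epsBit x xor epsBit y
  epsBit-* = residueCharacter-* (λ r → (r ≡ᵇ 3) ∨ (r ≡ᵇ 7)) _

  omegaBit-* : ∀ {x y} → ¬ + 2 ∣ x → ¬ + 2 ∣ y → omegaBit (x * y) ≡ omegaBit x xor omegaBit y
  omegaBit-* = residueCharacter-* (λ r → (r ≡ᵇ 3) ∨ (r ≡ᵇ 5)) _

module HilbertSymbol where

  open import Data.Bool.Properties using (∧-comm; ∧-assoc; ∧-idem; ∧-zeroʳ; ∧-distribʳ-xor; xor-identityʳ; xor-same)
  open Bits
  open Characters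

  record IsHilbertForm (H : ℚ → ℚ → Bool) : Set where
    field
      symmetric       : ∀ a b → H a b ≡ H b a
      multiplicativeˡ : ∀ a b c → a ≢ 0ℚ → b ≢ 0ℚ → H (a ℚ.* b) c ≡ H a c xor H b c
      diagonal        : ∀ a → a ≢ 0ℚ → H a a ≡ H (ℚ.- 1ℚ) a

  module _ {H : ℚ → ℚ → Bool} (isHilbertForm : IsHilbertForm H) where

    open IsHilbertForm isHilbertForm

    multiplicativeʳ : ∀ a b c → b ≢ 0ℚ → c ≢ 0ℚ → H a (b ℚ.* c) ≡ H a b xor H a c
    multiplicativeʳ a b c b≢0 c≢0 = begin
      H a (b ℚ.* c)       ≡⟨ symmetric a (b ℚ.* c) ⟩
      H (b ℚ.* c) a       ≡⟨ multiplicativeˡ b c a b≢0 c≢0 ⟩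
      H b a xor H c a     ≡⟨ cong₂ _xor_ (symmetric b a) (symmetric c a) ⟩
      H a b xor H a c     ∎
      where open ≡-Reasoning

    scale-both : ∀ l a b → l ≢ 0ℚ → a ≢ 0ℚ → b ≢ 0ℚ →
      H (l ℚ.* a) (l ℚ.* b) ≡ H a b xor (H l a xor (H l b xor H (ℚ.- 1ℚ) l))
    scale-both l a b l≢0 a≢0 b≢0 = begin
      H (l ℚ.* a) (l ℚ.* b)                              ≡⟨ multiplicativeˡ l a (l ℚ.* b) l≢0 a≢0 ⟩
      H l (l ℚ.* b) xor H a (l ℚ.* b)                    ≡⟨ cong₂ _xor_ (multiplicativeʳ l l b l≢0 b≢0) (multiplicativeʳ a l b l≢0 b≢0) ⟩
      (H l l xor H l b) xor (H a l xor H a b)            ≡⟨ cong (λ x → (x xor H l b) xor (H a l xor H a b)) (diagonal l l≢0) ⟩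
      (H (ℚ.- 1ℚ) l xor H l b) xor (H a l xor H a b)     ≡⟨ cong (λ x → (H (ℚ.- 1ℚ) l xor H l b) xor (x xor H a b)) (symmetric a l) ⟩
      (H (ℚ.- 1ℚ) l xor H l b) xor (H l a xor H a b)     ≡⟨ rearrange (H (ℚ.- 1ℚ) l) (H l b) (H l a) (H a b) ⟩
      H a b xor (H l a xor (H l b xor H (ℚ.- 1ℚ) l))     ∎
      where
        open ≡-Reasoning
        rearrange : ∀ w x y z → (w xor x) xor (y xor z) ≡ z xor (y xor (x xor w))
        rearrange = RingSolver.solve-∀ 𝔽₂

  hilbertBit∞-isHilbertForm : IsHilbertForm (hilbertBit ∞)
  hilbertBit∞-isHilbertForm = record
    { symmetric       = λ a b → ∧-comm (isNeg (↥ a)) (isNeg (↥ b))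
    ; multiplicativeˡ = λ a b c a≢0 b≢0 →
        trans (cong (_∧ isNeg (↥ c)) (isNeg∘↥-isCharacter a b a≢0 b≢0)) (∧-distribʳ-xor (isNeg (↥ c)) (isNeg (↥ a)) (isNeg (↥ b)))
    ; diagonal        = λ a _ → ∧-idem (isNeg (↥ a))
    }

  module AtTwo (p-prime : Prime 2) where

    open CharactersAtPrime 0 p-prime
    open OddResiduesMod8

    α ε ω : ℚ → Bool
    α = oddVal 0
    ε = unitCharacter epsBit
    ω = unitCharacter omegaBit

    -- hilbertBit (fin 2 _) a b is definitionally form (α a) (ε a) (ω a) (α b) (ε b) (ω b)
    form : Bool → Bool → Bool → Bool → Bool → Bool → Bool
    form αa εa ωa αb εb ωb = (εa ∧ εb) xor ((αa ∧ ωb) xor (αb ∧ ωa))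

    form-symmetric : ∀ αa εa ωa αb εb ωb → form αa εa ωa αb εb ωb ≡ form αb εb ωb αa εa ωa
    form-symmetric = identity
      where
        identity : ∀ αa εa ωa αb εb ωb →
          (εa ∧ εb) xor ((αa ∧ ωb) xor (αb ∧ ωa)) ≡ (εb ∧ εa) xor ((αb ∧ ωa) xor (αa ∧ ωb))
        identity = RingSolver.solve-∀ 𝔽₂

    form-linearˡ : ∀ αa εa ωa αb εb ωb αc εc ωc →
      form (αa xor αb) (εa xor εb) (ωa xor ωb) αc εc ωc ≡ form αa εa ωa αc εc ωc xor form αb εb ωb αc εc ωc
    form-linearˡ = identity
      where
        identity : ∀ αa εa ωa αb εb ωb αc εc ωc →
          ((εa xor εb) ∧ εc) xor (((αa xor αb) ∧ ωc) xor (αc ∧ (ωa xor ωb)))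
            ≡ ((εa ∧ εc) xor ((αa ∧ ωc) xor (αc ∧ ωa))) xor ((εb ∧ εc) xor ((αb ∧ ωc) xor (αc ∧ ωb)))
        identity = RingSolver.solve-∀ 𝔽₂

    form-diagonal : ∀ αa εa ωa → form αa εa ωa αa εa ωa ≡ form false true false αa εa ωa
    form-diagonal αa εa ωa = begin
      (εa ∧ εa) xor ((αa ∧ ωa) xor (αa ∧ ωa))   ≡⟨ cong₂ _xor_ (∧-idem εa) (xor-same (αa ∧ ωa)) ⟩
      εa xor false                              ≡⟨ cong (εa xor_) (∧-zeroʳ αa) ⟨
      εa xor (αa ∧ false)                       ∎
      where open ≡-Reasoning

    isHilbertForm : IsHilbertForm (hilbertBit (fin 2 p-prime))
    isHilbertForm = record
      { symmetric       = λ a b → form-symmetric (α a) (ε a) (ω a) (α b) (ε b) (ω b)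
      ; multiplicativeˡ = λ a b c a≢0 b≢0 → begin
          form (α (a ℚ.* b)) (ε (a ℚ.* b)) (ω (a ℚ.* b)) (α c) (ε c) (ω c)
            ≡⟨ cong₂ (λ x (yz : Bool × Bool) → form x (proj₁ yz) (proj₂ yz) (α c) (ε c) (ω c))
                 (oddVal-isCharacter a b a≢0 b≢0)
                 (cong₂ _,_ (unitCharacter-isCharacter {epsBit} epsBit-* a b a≢0 b≢0)
                            (unitCharacter-isCharacter {omegaBit} omegaBit-* a b a≢0 b≢0)) ⟩
          form (α a xor α b) (ε a xor ε b) (ω a xor ω b) (α c) (ε c) (ω c)
            ≡⟨ form-linearˡ (α a) (ε a) (ω a) (α b) (ε b) (ω b) (α c) (ε c) (ω c) ⟩
          form (α a) (ε a) (ω a) (α c) (ε c) (ω c) xor form (α b) (ε b) (ω b) (α c) (ε c) (ω c) ∎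
      ; diagonal        = λ a _ → form-diagonal (α a) (ε a) (ω a)
      }
      where open ≡-Reasoning

  module AtOddPrime (q : ℕ) (p-prime : Prime (suc (suc (suc q)))) where

    open CharactersAtPrime (suc q) p-prime
    open LegendreSymbol q p-prime

    εp : Bool
    εp = ((suc (suc q) ℕ./ 2) ℕ.% 2) ≡ᵇ 1

    α l : ℚ → Bool
    α = oddVal (suc q)
    l = unitCharacter (legBit q)

    form : Bool → Bool → Bool → Bool → Bool
    form αa la αb lb = (αa ∧ αb ∧ εp) xor ((αb ∧ la) xor (αa ∧ lb))

    form-symmetric : ∀ αa la αb lb → form αa la αb lb ≡ form αb lb αa la
    form-symmetric = identity εp
      where
        identity : ∀ e αa la αb lb →
          (αa ∧ αb ∧ e) xor ((αb ∧ la) xor (αa ∧ lb)) ≡ (αb ∧ αa ∧ e) xor ((αa ∧ lb) xor (αb ∧ la))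
        identity = RingSolver.solve-∀ 𝔽₂

    form-linearˡ : ∀ αa la αb lb αc lc →
      form (αa xor αb) (la xor lb) αc lc ≡ form αa la αc lc xor form αb lb αc lc
    form-linearˡ = identity εp
      where
        identity : ∀ e αa la αb lb αc lc →
          ((αa xor αb) ∧ αc ∧ e) xor ((αc ∧ (la xor lb)) xor ((αa xor αb) ∧ lc))
            ≡ ((αa ∧ αc ∧ e) xor ((αc ∧ la) xor (αa ∧ lc))) xor ((αb ∧ αc ∧ e) xor ((αc ∧ lb) xor (αb ∧ lc)))
        identity = RingSolver.solve-∀ 𝔽₂

    l-neg1 : l (ℚ.- 1ℚ) ≡ εp xor false
    l-neg1 = cong₂ _xor_ legBit-neg1 legBit-1

    form-diagonal : ∀ αa la → form αa la αa la ≡ form false (εp xor false) αa la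
    form-diagonal αa la = begin
      (αa ∧ αa ∧ εp) xor ((αa ∧ la) xor (αa ∧ la))  ≡⟨ cong₂ _xor_ (sym (∧-assoc αa αa εp)) (xor-same (αa ∧ la)) ⟩
      ((αa ∧ αa) ∧ εp) xor false                    ≡⟨ cong (λ x → (x ∧ εp) xor false) (∧-idem αa) ⟩
      (αa ∧ εp) xor false                           ≡⟨ cong (λ x → (αa ∧ x) xor false) (xor-identityʳ εp) ⟨
      (αa ∧ (εp xor false)) xor false               ∎
      where open ≡-Reasoning

    isHilbertForm : IsHilbertForm (hilbertBit (fin (suc (suc (suc q))) p-prime))
    isHilbertForm = record
      { symmetric       = λ a b → form-symmetric (α a) (l a) (α b) (l b)
      ; multiplicativeˡ = λ a b c a≢0 b≢0 → begin
          form (α (a ℚ.* b)) (l (a ℚ.* b)) (α c) (l c)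
            ≡⟨ cong₂ (λ x y → form x y (α c) (l c)) (oddVal-isCharacter a b a≢0 b≢0)
                                                     (unitCharacter-isCharacter {legBit q} legBit-* a b a≢0 b≢0) ⟩
          form (α a xor α b) (l a xor l b) (α c) (l c)
            ≡⟨ form-linearˡ (α a) (l a) (α b) (l b) (α c) (l c) ⟩
          form (α a) (l a) (α c) (l c) xor form (α b) (l b) (α c) (l c) ∎
      ; diagonal        = λ a _ → trans (form-diagonal (α a) (l a)) (cong (λ x → form false x (α a) (l a)) (sym l-neg1))
      }
      where open ≡-Reasoning

  hilbertBit-isHilbertForm : ∀ v → IsHilbertForm (hilbertBit v)
  hilbertBit-isHilbertForm ∞                                = hilbertBit∞-isHilbertForm
  hilbertBit-isHilbertForm (fin (suc (suc zero)) p-prime)    = AtTwo.isHilbertForm p-prime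
  hilbertBit-isHilbertForm (fin (suc (suc (suc q))) p-prime) = AtOddPrime.isHilbertForm q p-prime

module FinSums where

  open import Algebra.Bundles using (CommutativeRing)
  open import Data.Bool.Properties using (xor-∧-commutativeRing; ∧-zeroʳ; ∧-distribˡ-xor)
  open Bits
  open import Algebra.Properties.Semiring.Sum (CommutativeRing.semiring xor-∧-commutativeRing) public
    using (sum; sum-syntax; sum-cong-≗; sum-replicate-zero; ∑-distrib-+; ∑-comm; *-distribˡ-sum)

  _≺_ : ∀ {n} → Fin n → Fin n → Bool
  i ≺ j = toℕ i <ᵇ toℕ j

  ∑-pairs : ∀ {n} → (Fin n → Fin n → Bool) → Bool
  ∑-pairs {n} F = ∑[ i < n ] ∑[ j < n ] ((i ≺ j) ∧ F i j)

  prodFin-sgn : ∀ {n} {F : Fin n → ℤ} {G : Fin n → Bool} → (∀ i → F i ≡ sgn (G i)) → prodFin F ≡ sgn (sum G)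
  prodFin-sgn {zero}              _   = refl
  prodFin-sgn {suc n} {F} {G} F≡ = trans (cong₂ _*_ (F≡ fz) (prodFin-sgn (F≡ ∘ fs))) (sym (sgn-xor (G fz) _))

  prodPairs-sgn : ∀ {n} {F : Fin n → Fin n → ℤ} {G : Fin n → Fin n → Bool} →
    (∀ i j → F i j ≡ sgn (G i j)) → prodPairs F ≡ sgn (∑-pairs G)
  prodPairs-sgn F≡ = prodFin-sgn λ i → prodFin-sgn λ j → if-sgn (i ≺ j) (F≡ i j)
    where
      if-sgn : ∀ c {x b} → x ≡ sgn b → (if c then x else + 1) ≡ sgn (c ∧ b)
      if-sgn true  x≡ = x≡
      if-sgn false _  = refl

  odd-sumFin : ∀ {n} (f : Fin n → ℕ) → odd (sumFin f) ≡ sum (odd ∘ f)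
  odd-sumFin {zero}  f = refl
  odd-sumFin {suc n} f = trans (odd-+ (f fz) _) (cong (odd (f fz) xor_) (odd-sumFin (f ∘ fs)))

  odd-sumPairs : ∀ {n} (f : Fin n → Fin n → ℕ) → odd (sumPairs f) ≡ ∑-pairs (λ i j → odd (f i j))
  odd-sumPairs {n} f = trans (odd-sumFin (λ i → sumFin (λ j → if i ≺ j then f i j else 0)))
    (sum-cong-≗ λ i → trans (odd-sumFin (λ j → if i ≺ j then f i j else 0)) (sum-cong-≗ λ j → odd-if (i ≺ j)))
    where
      odd-if : ∀ c {m} → odd (if c then m else 0) ≡ c ∧ odd m
      odd-if true  = refl
      odd-if false = refl

  ∑-pairs-cong : ∀ {n} {F G : Fin n → Fin n → Bool} → (∀ i j → F i j ≡ G i j) → ∑-pairs F ≡ ∑-pairs G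
  ∑-pairs-cong F≡G = sum-cong-≗ λ i → sum-cong-≗ λ j → cong ((i ≺ j) ∧_) (F≡G i j)

  ∑-pairs-distrib-xor : ∀ {n} (F G : Fin n → Fin n → Bool) →
    ∑-pairs (λ i j → F i j xor G i j) ≡ ∑-pairs F xor ∑-pairs G
  ∑-pairs-distrib-xor {n} F G = trans
    (sum-cong-≗ λ i → trans (sum-cong-≗ λ j → ∧-distribˡ-xor (i ≺ j) (F i j) (G i j))
                            (∑-distrib-+ (λ j → (i ≺ j) ∧ F i j) (λ j → (i ≺ j) ∧ G i j)))
    (∑-distrib-+ (λ i → ∑[ j < n ] ((i ≺ j) ∧ F i j)) (λ i → ∑[ j < n ] ((i ≺ j) ∧ G i j)))

  ∑-pairs-∧ : ∀ {n} k (F : Fin n → Fin n → Bool) → ∑-pairs (λ i j → k ∧ F i j) ≡ k ∧ ∑-pairs F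
  ∑-pairs-∧ {n} k F = begin
    ∑[ i < n ] ∑[ j < n ] ((i ≺ j) ∧ (k ∧ F i j))   ≡⟨ sum-cong-≗ (λ i → sum-cong-≗ λ j → ∧-swap (i ≺ j) k (F i j)) ⟩
    ∑[ i < n ] ∑[ j < n ] (k ∧ ((i ≺ j) ∧ F i j))   ≡⟨ sum-cong-≗ (λ i → *-distribˡ-sum k (λ j → (i ≺ j) ∧ F i j)) ⟨
    ∑[ i < n ] (k ∧ ∑[ j < n ] ((i ≺ j) ∧ F i j))   ≡⟨ *-distribˡ-sum k (λ i → ∑[ j < n ] ((i ≺ j) ∧ F i j)) ⟨
    k ∧ ∑-pairs F                                   ∎
    where
      open ≡-Reasoning
      ∧-swap : ∀ a b c → a ∧ (b ∧ c) ≡ b ∧ (a ∧ c)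
      ∧-swap = RingSolver.solve-∀ 𝔽₂

  private
    <ᵇ-xor->ᵇ : ∀ {m n} → m ≢ n → (m <ᵇ n) xor (n <ᵇ m) ≡ true
    <ᵇ-xor->ᵇ {zero}  {zero}  0≢0 = ⊥-elim (0≢0 refl)
    <ᵇ-xor->ᵇ {zero}  {suc n} _   = refl
    <ᵇ-xor->ᵇ {suc m} {zero}  _   = refl
    <ᵇ-xor->ᵇ {suc m} {suc n} m≢n = <ᵇ-xor->ᵇ (m≢n ∘ cong suc)

    ≺-xor-≻ : ∀ {n} (e : Fin n → Fin n → Bool) → (∀ i → e i i ≡ false) →
      ∀ i j → ((i ≺ j) xor (j ≺ i)) ∧ e i j ≡ e i j
    ≺-xor-≻ e e-diag i j with i Fin.≟ j
    ... | yes refl rewrite e-diag i = ∧-zeroʳ _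
    ... | no i≢j   rewrite <ᵇ-xor->ᵇ (i≢j ∘ Fin.toℕ-injective) = refl

  ∑-pairs-xor : ∀ {n} (e : Fin n → Fin n → Bool) (x : Fin n → Bool) →
    (∀ i j → e i j ≡ e j i) → (∀ i → e i i ≡ false) →
    ∑-pairs (λ i j → e i j ∧ (x i xor x j)) ≡ ∑[ i < n ] (x i ∧ ∑[ j < n ] e i j)
  ∑-pairs-xor {n} e x e-sym e-diag = begin
    ∑[ i < n ] ∑[ j < n ] ((i ≺ j) ∧ (e i j ∧ (x i xor x j)))
      ≡⟨ sum-cong-≗ (λ i → trans (sum-cong-≗ λ j → split (i ≺ j) (e i j) (x i) (x j)) (∑-distrib-+ (A i) (B i))) ⟩
    ∑[ i < n ] (∑[ j < n ] A i j xor ∑[ j < n ] B i j)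
      ≡⟨ ∑-distrib-+ (λ i → ∑[ j < n ] A i j) (λ i → ∑[ j < n ] B i j) ⟩
    ∑[ i < n ] ∑[ j < n ] A i j xor ∑[ i < n ] ∑[ j < n ] B i j
      ≡⟨ cong (∑[ i < n ] ∑[ j < n ] A i j xor_) (trans (∑-comm B)
           (sum-cong-≗ λ i → sum-cong-≗ λ j → cong (λ eji → (j ≺ i) ∧ (eji ∧ x i)) (e-sym j i))) ⟩
    ∑[ i < n ] ∑[ j < n ] A i j xor ∑[ i < n ] ∑[ j < n ] C i j
      ≡⟨ sym (trans (sum-cong-≗ λ i → ∑-distrib-+ (A i) (C i)) (∑-distrib-+ (λ i → ∑[ j < n ] A i j) (λ i → ∑[ j < n ] C i j))) ⟩
    ∑[ i < n ] ∑[ j < n ] (A i j xor C i j)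
      ≡⟨ sum-cong-≗ (λ i → sum-cong-≗ λ j → trans (factor (i ≺ j) (j ≺ i) (e i j) (x i)) (cong (x i ∧_) (≺-xor-≻ e e-diag i j))) ⟩
    ∑[ i < n ] ∑[ j < n ] (x i ∧ e i j)
      ≡⟨ sum-cong-≗ (λ i → sym (*-distribˡ-sum (x i) (e i))) ⟩
    ∑[ i < n ] (x i ∧ ∑[ j < n ] e i j) ∎
    where
      open ≡-Reasoning
      A B C : Fin n → Fin n → Bool
      A i j = (i ≺ j) ∧ (e i j ∧ x i)
      B i j = (i ≺ j) ∧ (e i j ∧ x j)
      C i j = (j ≺ i) ∧ (e i j ∧ x i)
      split : ∀ c e a b → c ∧ (e ∧ (a xor b)) ≡ (c ∧ (e ∧ a)) xor (c ∧ (e ∧ b))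
      split = RingSolver.solve-∀ 𝔽₂
      factor : ∀ c d e a → (c ∧ (e ∧ a)) xor (d ∧ (e ∧ a)) ≡ a ∧ ((c xor d) ∧ e)
      factor = RingSolver.solve-∀ 𝔽₂

  ∑-pairs-xor-evenRows : ∀ {n} (e : Fin n → Fin n → Bool) (x : Fin n → Bool) →
    (∀ i j → e i j ≡ e j i) → (∀ i → e i i ≡ false) → (∀ i → ∑[ j < n ] e i j ≡ false) →
    ∑-pairs (λ i j → e i j ∧ (x i xor x j)) ≡ false
  ∑-pairs-xor-evenRows {n} e x e-sym e-diag e-rows = begin
    ∑-pairs (λ i j → e i j ∧ (x i xor x j))   ≡⟨ ∑-pairs-xor e x e-sym e-diag ⟩
    ∑[ i < n ] (x i ∧ ∑[ j < n ] e i j)        ≡⟨ sum-cong-≗ (λ i → trans (cong (x i ∧_) (e-rows i)) (∧-zeroʳ (x i))) ⟩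
    ∑[ i < n ] false                          ≡⟨ sum-replicate-zero n ⟩
    false                                     ∎
    where open ≡-Reasoning

module SubsetParity where

  open Bits
  open FinSums
  open import Data.Vec using (Vec; []; _∷_; lookup)
  import Data.Vec.Properties as Vec
  import Data.Fin.Subset as Subset

  parity : ∀ {n} → SetN- n → Bool
  parity {n} A = ∑[ j < n ] memN j A

  odd-cardN : ∀ {n} (A : SetN- n) → odd (cardN A) ≡ parity A
  odd-cardN (_ ∷ A) = odd-count A
    where
      odd-count : ∀ {n} (v : Vec Bool n) → odd (Subset.∣ v ∣) ≡ sum (lookup v)
      odd-count []          = refl
      odd-count (true ∷ v)  = cong not (odd-count v)
      odd-count (false ∷ v) = odd-count v

  parity-⊕ : ∀ {n} (A B : SetN- n) → parity (A ⊕ B) ≡ parity A xor parity B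
  parity-⊕ A B = trans (sum-cong-≗ λ j → Vec.lookup-zipWith _xor_ (fs j) A B) (∑-distrib-+ (λ j → memN j A) (λ j → memN j B))

  parity-∅ : ∀ {n} → parity {n} ∅ ≡ false
  parity-∅ {n} = trans (sum-cong-≗ {n} λ j → Vec.lookup-replicate (fs j) false) (sum-replicate-zero n)

  parity-linComb : ∀ {n m} c (v : Fin m → SetN- n) → (∀ k → parity (v k) ≡ false) → parity (linComb c v) ≡ false
  parity-linComb {n} {zero} c v _ = parity-∅ {n}
  parity-linComb {n} {suc m} c v even = begin
    parity ((if c fz then v fz else ∅) ⊕ linComb (c ∘ fs) (v ∘ fs))
      ≡⟨ parity-⊕ (if c fz then v fz else ∅) (linComb (c ∘ fs) (v ∘ fs)) ⟩
    parity (if c fz then v fz else ∅) xor parity (linComb (c ∘ fs) (v ∘ fs))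
      ≡⟨ cong₂ _xor_ (head-even (c fz)) (parity-linComb (c ∘ fs) (v ∘ fs) (even ∘ fs)) ⟩
    false ∎
    where
      open ≡-Reasoning
      head-even : ∀ b → parity (if b then v fz else ∅) ≡ false
      head-even true  = even fz
      head-even false = parity-∅ {n}

  parity-span : ∀ {n m} {v : Fin m → SetN- n} {A} → (∀ k → parity (v k) ≡ false) → InSpan v A → parity A ≡ false
  parity-span {v = v} even (c , refl) = parity-linComb c v even

module Twist where

  open Bits
  open FinSums
  open HilbertSymbol
  open import Data.Bool.Properties using (∧-distribˡ-xor)
  open import Data.Vec using (lookup)

  module _ {n} (f : Fin n → SetN- n) where

    minusBit : Fin n → Bool
    minusBit i = lookup (f i) minusIdx

    pairBit : Fin n → Fin n → Bool
    pairBit i j = memN j (f i)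

    minusTerm : (ℚ → ℚ → Bool) → (Fin n → ℚ) → Bool
    minusTerm H a = ∑[ i < n ] (H (ℚ.- 1ℚ) (a i) ∧ minusBit i)

    pairTerm : (ℚ → ℚ → Bool) → (Fin n → ℚ) → Bool
    pairTerm H a = ∑-pairs (λ i j → H (a i) (a j) ∧ pairBit i j)

    twBit : (ℚ → ℚ → Bool) → (Fin n → ℚ) → Bool
    twBit H a = minusTerm H a xor pairTerm H a

  sgn^ind : ∀ b c → sgn b ^ ind c ≡ sgn (b ∧ c)
  sgn^ind true  true  = refl
  sgn^ind true  false = refl
  sgn^ind false true  = refl
  sgn^ind false false = refl

  Tw≡sgn∘twBit : ∀ {n} v (f : Fin n → SetN- n) a → Tw v f a ≡ sgn (twBit f (hilbertBit v) a)
  Tw≡sgn∘twBit v f a = trans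
    (cong₂ _*_ (prodFin-sgn λ i → sgn^ind (hilbertBit v (ℚ.- 1ℚ) (a i)) (minusBit f i))
               (prodPairs-sgn λ i j → sgn^ind (hilbertBit v (a i) (a j)) (pairBit f i j)))
    (sym (sgn-xor (minusTerm f (hilbertBit v) a) (pairTerm f (hilbertBit v) a)))

  ind-injective : ∀ {b c} → ind b ≡ ind c → b ≡ c
  ind-injective {true}  {true}  _ = refl
  ind-injective {false} {false} _ = refl

  odd-exponent : ∀ {n} (f : Fin n → SetN- n) →
    odd (sumFin (λ i → ind (minusBit f i)) ℕ.+ sumPairs (λ i j → ind (pairBit f i j)))
      ≡ ∑[ i < n ] minusBit f i xor ∑-pairs (pairBit f)
  odd-exponent f = trans (odd-+ (sumFin (ind ∘ minusBit f)) (sumPairs (λ i j → ind (pairBit f i j)))) (cong₂ _xor_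
    (trans (odd-sumFin (ind ∘ minusBit f)) (sum-cong-≗ λ i → odd-ind (minusBit f i)))
    (trans (odd-sumPairs (λ i j → ind (pairBit f i j))) (∑-pairs-cong λ i j → odd-ind (pairBit f i j))))
    where
      odd-ind : ∀ b → odd (ind b) ≡ b
      odd-ind true  = refl
      odd-ind false = refl

  module _ {H : ℚ → ℚ → Bool} (isHilbertForm : IsHilbertForm H) {n} (f : Fin n → SetN- n)
           (pair-sym  : ∀ i j → pairBit f i j ≡ pairBit f j i)
           (pair-diag : ∀ i → pairBit f i i ≡ false)
           (row-even  : ∀ i → ∑[ j < n ] pairBit f i j ≡ false) where

    open IsHilbertForm isHilbertForm

    private
      -1ℚ : ℚ
      -1ℚ = ℚ.- 1ℚ

      minus-terms : ∀ h k m → (h ∧ m) xor ((k xor h) ∧ m) ≡ k ∧ m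
      minus-terms h k m = trans (rearrange h k m) (xor-cancelˡ (h ∧ m) (k ∧ m))
        where rearrange : ∀ h k m → (h ∧ m) xor ((k xor h) ∧ m) ≡ (h ∧ m) xor ((h ∧ m) xor (k ∧ m))
              rearrange = RingSolver.solve-∀ 𝔽₂

      pair-terms : ∀ h x y k e → (h ∧ e) xor ((h xor (x xor (y xor k))) ∧ e) ≡ (e ∧ (x xor y)) xor (k ∧ e)
      pair-terms h x y k e = trans (rearrange h x y k e) (xor-cancelˡ (h ∧ e) _)
        where rearrange : ∀ h x y k e → (h ∧ e) xor ((h xor (x xor (y xor k))) ∧ e)
                                        ≡ (h ∧ e) xor ((h ∧ e) xor ((e ∧ (x xor y)) xor (k ∧ e)))
              rearrange = RingSolver.solve-∀ 𝔽₂

    minusTerm-scale : ∀ {l} {a : Fin n → ℚ} → l ≢ 0ℚ → (∀ i → a i ≢ 0ℚ) →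
      minusTerm f H a xor minusTerm f H (scale l a) ≡ H -1ℚ l ∧ ∑[ i < n ] minusBit f i
    minusTerm-scale {l} {a} l≢0 a≢0 = begin
      minusTerm f H a xor minusTerm f H (scale l a)
        ≡⟨ ∑-distrib-+ (λ i → H -1ℚ (a i) ∧ minusBit f i) (λ i → H -1ℚ (l ℚ.* a i) ∧ minusBit f i) ⟨
      ∑[ i < n ] ((H -1ℚ (a i) ∧ minusBit f i) xor (H -1ℚ (l ℚ.* a i) ∧ minusBit f i))
        ≡⟨ sum-cong-≗ (λ i → trans (cong (λ h → (H -1ℚ (a i) ∧ minusBit f i) xor (h ∧ minusBit f i))
                                          (multiplicativeʳ isHilbertForm -1ℚ l (a i) l≢0 (a≢0 i)))
                                    (minus-terms (H -1ℚ (a i)) (H -1ℚ l) (minusBit f i))) ⟩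
      ∑[ i < n ] (H -1ℚ l ∧ minusBit f i)
        ≡⟨ *-distribˡ-sum (H -1ℚ l) (minusBit f) ⟨
      H -1ℚ l ∧ ∑[ i < n ] minusBit f i ∎
      where open ≡-Reasoning

    pairTerm-scale : ∀ {l} {a : Fin n → ℚ} → l ≢ 0ℚ → (∀ i → a i ≢ 0ℚ) →
      pairTerm f H a xor pairTerm f H (scale l a) ≡ H -1ℚ l ∧ ∑-pairs (pairBit f)
    pairTerm-scale {l} {a} l≢0 a≢0 = begin
      pairTerm f H a xor pairTerm f H (scale l a)
        ≡⟨ ∑-pairs-distrib-xor (λ i j → H (a i) (a j) ∧ pairBit f i j) (λ i j → H (l ℚ.* a i) (l ℚ.* a j) ∧ pairBit f i j) ⟨
      ∑-pairs (λ i j → (H (a i) (a j) ∧ pairBit f i j) xor (H (l ℚ.* a i) (l ℚ.* a j) ∧ pairBit f i j))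
        ≡⟨ ∑-pairs-cong (λ i j → trans (cong (λ h → (H (a i) (a j) ∧ pairBit f i j) xor (h ∧ pairBit f i j))
                                             (scale-both isHilbertForm l (a i) (a j) l≢0 (a≢0 i) (a≢0 j)))
                                       (pair-terms (H (a i) (a j)) (x i) (x j) (H -1ℚ l) (pairBit f i j))) ⟩
      ∑-pairs (λ i j → (pairBit f i j ∧ (x i xor x j)) xor (H -1ℚ l ∧ pairBit f i j))
        ≡⟨ ∑-pairs-distrib-xor (λ i j → pairBit f i j ∧ (x i xor x j)) (λ i j → H -1ℚ l ∧ pairBit f i j) ⟩
      ∑-pairs (λ i j → pairBit f i j ∧ (x i xor x j)) xor ∑-pairs (λ i j → H -1ℚ l ∧ pairBit f i j)
        ≡⟨ cong₂ _xor_ (∑-pairs-xor-evenRows (pairBit f) x pair-sym pair-diag row-even) (∑-pairs-∧ (H -1ℚ l) (pairBit f)) ⟩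
      false xor (H -1ℚ l ∧ ∑-pairs (pairBit f)) ∎
      where
        open ≡-Reasoning
        x : Fin n → Bool
        x i = H l (a i)

    twBit-scale : ∀ {l} {a : Fin n → ℚ} → l ≢ 0ℚ → (∀ i → a i ≢ 0ℚ) →
      twBit f H a xor twBit f H (scale l a) ≡ H -1ℚ l ∧ (∑[ i < n ] minusBit f i xor ∑-pairs (pairBit f))
    twBit-scale {l} {a} l≢0 a≢0 = begin
      (M a xor P a) xor (M (scale l a) xor P (scale l a))            ≡⟨ xor-interchange (M a) (P a) (M (scale l a)) (P (scale l a)) ⟩
      (M a xor M (scale l a)) xor (P a xor P (scale l a))            ≡⟨ cong₂ _xor_ (minusTerm-scale l≢0 a≢0) (pairTerm-scale l≢0 a≢0) ⟩
      (H -1ℚ l ∧ ∑[ i < n ] minusBit f i) xor (H -1ℚ l ∧ ∑-pairs (pairBit f))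
        ≡⟨ ∧-distribˡ-xor (H -1ℚ l) (∑[ i < n ] minusBit f i) (∑-pairs (pairBit f)) ⟨
      H -1ℚ l ∧ (∑[ i < n ] minusBit f i xor ∑-pairs (pairBit f))    ∎
      where
        open ≡-Reasoning
        M P : (Fin n → ℚ) → Bool
        M = minusTerm f H
        P = pairTerm f H

open import Data.Nat using (_≥_)
open import Data.Nat.Divisibility using (_∣_)
open import Data.Rational using (-_)
open import Data.Vec using (lookup)
open Bits using (sgn; sgn-xor; sgn^; odd; even⇒odd≡false)
open FinSums using (sum; sum-syntax; ∑-pairs)
open SubsetParity using (odd-cardN; parity-span)
open HilbertSymbol using (hilbertBit-isHilbertForm)
open Twist

lemma4p8 : (n m : ℕ) → n ≥ 2 → m ≥ 1 → (S : Monos n m) → PairwiseCoprime S →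
    (∀ (i : Fin m) (j : Fin n) → 2 ∣ cardN (g S i j)) →
    (f : Fin n → SetN- n) →
    (∀ j → InV S j (f j)) →
    (∀ j → ind (memN j (f j)) ≡ 0) →
    (∀ i j → ind (memN i (f j)) ≡ ind (memN j (f i))) →
    (λ' : ℚ) → λ' ≢ 0ℚ → (a : Fin n → ℚ) → (∀ i → a i ≢ 0ℚ) → (v : Place) →
    Tw v f a * Tw v f (scale λ' a)
      ≡ hilbert v (- 1ℚ) λ' ^ (sumFin (λ i → ind (lookup (f i) minusIdx))
                                Data.Nat.+ sumPairs (λ i j → ind (memN j (f i))))
lemma4p8 n m _ _ S _ g-even f f∈V f-diag f-sym λ' λ'≢0 a a≢0 v = begin
  Tw v f a * Tw v f (scale λ' a)
    ≡⟨ cong₂ _*_ (Tw≡sgn∘twBit v f a) (Tw≡sgn∘twBit v f (scale λ' a)) ⟩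
  sgn (twBit f H a) * sgn (twBit f H (scale λ' a))
    ≡⟨ sgn-xor (twBit f H a) (twBit f H (scale λ' a)) ⟨
  sgn (twBit f H a xor twBit f H (scale λ' a))
    ≡⟨ cong sgn (twBit-scale (hilbertBit-isHilbertForm v) f pair-sym pair-diag row-even λ'≢0 a≢0) ⟩
  sgn (H (- 1ℚ) λ' ∧ (∑[ i < n ] minusBit f i xor ∑-pairs (pairBit f)))
    ≡⟨ cong (λ b → sgn (H (- 1ℚ) λ' ∧ b)) (odd-exponent f) ⟨
  sgn (H (- 1ℚ) λ' ∧ odd N)
    ≡⟨ sgn^ (H (- 1ℚ) λ') N ⟨
  hilbert v (- 1ℚ) λ' ^ N ∎
  where
    open ≡-Reasoning
    H = hilbertBit v
    N = sumFin (λ i → ind (lookup (f i) minusIdx)) Data.Nat.+ sumPairs (λ i j → ind (memN j (f i)))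
    pair-sym : ∀ i j → pairBit f i j ≡ pairBit f j i
    pair-sym i j = sym (ind-injective (f-sym i j))
    pair-diag : ∀ i → pairBit f i i ≡ false
    pair-diag i = ind-injective (f-diag i)
    row-even : ∀ i → ∑[ j < n ] pairBit f i j ≡ false
    row-even i = parity-span (λ k → trans (sym (odd-cardN (g S k i))) (even⇒odd≡false (g-even k i))) (f∈V i)
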